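{- For each $r\in\mathbb{N}$ there exist polynomials $P_r(n), \overline{P}_r(n), Q_r(n), \overline{Q}_r(n)$ of degree $r$ with integer coefficients such that, for all positive integers $n$, \begin{align*} U_{2r+1}(2n) &= nP_r(n)\binom{2n}{n},\\ U_{2r+1}(2n-1) &= 2^{ -(2r+1)}n\overline{P}_r(n)\binom{2n}{n},\\ U_{2r}(2n) &= 2^{2n-r}Q_r(n),\\ U_{2r}(2n+1) &= 2^{2n+1-2r}\overline{Q}_r(n). \end{align*} These polynomials satisfy the recurrences \begin{align*} P_{r+1}(n) &= n^2 P_r(n) -n(n-1)P_r(n-1),\\ \overline{P}_{r+1}(n) &= (2n-1)^2\,\overline{P}_r(n) - 4(n-1)^2\,\overline{P}_r(n-1),\\ Q_{r+1}(n) &= 2n^2 Q_r(n) - n(2n-1)Q_r(n-1),\\ \overline{Q}_{r+1}(n) &= (2n+1)^2\,\overline{Q}_r(n) - 2n(2n+1)\overline{Q}_r(n-1), \end{align*} with initial conditions $P_0(n) = \overline{P}_0(n) = Q_0(n) = \overline{Q}_0(n) = 1$.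
   Context: $\mathbb{N}$ denotes the non-negative integers. For $r\in\mathbb{N}$ and $n\in\mathbb{Z}$ define \[ U_r(n) = \sum_{k\in\mathbb{Z}} \binom{n}{k}\left|\frac{n}{2}-k\right|^r, \] where $0^0$ is interpreted as $1$, and for $n\in\mathbb{N}$ the binomial coefficient $\binom{n}{k}$ is $0$ if $k<0$ or $k>n$ and $\frac{n!}{(n-k)!\,k!}$ otherwise; $U_r(n)=0$ for $n<0$. -}

module Defs where

open import Data.Nat as ℕ using (ℕ; zero; suc)
open import Data.Nat.Combinatorics using (_C_)
open import Data.Integer as ℤ using (ℤ; +_)
open import Data.Rational as ℚ using (ℚ; 0ℚ; 1ℚ; ½; ∣_∣)
open import Data.List using (List; []; _∷_; length; upTo; map; foldr)
open import Data.Product using (_×_)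
open import Relation.Binary.PropositionalEquality using (_≡_; _≢_)

ℕ→ℚ : ℕ → ℚ
ℕ→ℚ n = + n ℚ./ 1

ℤ→ℚ : ℤ → ℚ
ℤ→ℚ z = z ℚ./ 1

-- natural-number powers in ℚ (so q ^ 0 = 1, in particular 0 ^ 0 = 1)
_^ℚ_ : ℚ → ℕ → ℚ
q ^ℚ zero = 1ℚ
q ^ℚ suc m = q ℚ.* (q ^ℚ m)

sumℚ : List ℚ → ℚ
sumℚ = foldr ℚ._+_ 0ℚ

-- U_r(n) = Σ_k binom(n,k) |n/2 - k|^r ; binom(n,k) = 0 outside 0 ≤ k ≤ n,
-- so the sum ranges over k = 0 .. n.
U : ℕ → ℕ → ℚ
U r n = sumℚ (map (λ k → ℕ→ℚ (n C k) ℚ.* (∣ ℕ→ℚ n ℚ.* ½ ℚ.- ℕ→ℚ k ∣ ^ℚ r)) (upTo (suc n)))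

-- Polynomials with integer coefficients: coefficient lists, constant term first.
Poly : Set
Poly = List ℤ

eval : Poly → ℤ → ℤ
eval [] x = + 0
eval (a ∷ p) x = a ℤ.+ x ℤ.* eval p x

lastCoeff : Poly → ℤ
lastCoeff [] = + 0
lastCoeff (a ∷ []) = a
lastCoeff (a ∷ b ∷ p) = lastCoeff (b ∷ p)

HasDegree : Poly → ℕ → Set
HasDegree p d = (length p ≡ suc d) × (lastCoeff p ≢ + 0)

-- Write V_r(n) = 2^r U_r(n) = Σ_k C(n,k) |n − 2k|^r, a natural number. Since |N − 2k|² + 4k(N − k) = N²
-- and k(N − k) C(N,k) = N(N − 1) C(N − 2, k − 1), these satisfy V_{r+2}(N) = N² V_r(N) − 4N(N − 1) V_r(N − 2).
-- From V_0(n) = 2^n, V_1(2m) = 2m C(2m,m) and V_1(2m+1) = (m+1) C(2m+2,m+1), induction on r in each parity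
-- class gives the four closed forms: the recurrence for V becomes the stated recurrence for the polynomial,
-- with x C(2x,x) = 2(2x − 1) C(2x − 2, x − 1) absorbing the binomial factor in the odd cases. Each recurrence
-- p_{r+1} = A p_r − B p_r(· − 1) multiplies the leading coefficient by a positive integer, so deg p_r = r.

module Submission where

module Moments where

  open import Data.Nat
  open import Data.Nat.Properties
  open import Data.Nat.Combinatorics using (_C_; nCk+nC[k+1]≡[n+1]C[k+1]; nCk≡nC[n∸k]; nCn≡1)
  open import Data.Nat.Tactic.RingSolver using (solve-∀)
  open import Algebra.Properties.CommutativeSemigroup +-commutativeSemigroup
    using (x∙yz≈y∙xz) renaming (interchange to +-interchange)
  open import Function using (_∘_)
  open import Relation.Binary.PropositionalEquality
  open import Relation.Nullary using (yes; no)
  open ≡-Reasoning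

  ∑< : ℕ → (ℕ → ℕ) → ℕ
  ∑< zero    f = 0
  ∑< (suc m) f = f 0 + ∑< m (f ∘ suc)

  infix 5 ∑<
  syntax ∑< m (λ k → e) = ∑[ k < m ] e

  ∑-cong : ∀ m {f g : ℕ → ℕ} → (∀ k → f k ≡ g k) → ∑< m f ≡ ∑< m g
  ∑-cong zero    f≡g = refl
  ∑-cong (suc m) f≡g = cong₂ _+_ (f≡g 0) (∑-cong m (f≡g ∘ suc))

  ∑-zero : ∀ m → ∑[ k < m ] 0 ≡ 0
  ∑-zero zero    = refl
  ∑-zero (suc m) = ∑-zero m

  ∑-distrib-+ : ∀ m (f g : ℕ → ℕ) → ∑[ k < m ] (f k + g k) ≡ ∑< m f + ∑< m g
  ∑-distrib-+ zero    f g = refl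
  ∑-distrib-+ (suc m) f g = begin
    f 0 + g 0 + ∑< m (λ k → f (suc k) + g (suc k)) ≡⟨ cong (f 0 + g 0 +_) (∑-distrib-+ m (f ∘ suc) (g ∘ suc)) ⟩
    f 0 + g 0 + (∑< m (f ∘ suc) + ∑< m (g ∘ suc))  ≡⟨ +-interchange (f 0) (g 0) _ _ ⟩
    f 0 + ∑< m (f ∘ suc) + (g 0 + ∑< m (g ∘ suc))  ∎

  ∑-distribˡ-* : ∀ m c (f : ℕ → ℕ) → ∑[ k < m ] (c * f k) ≡ c * ∑< m f
  ∑-distribˡ-* zero    c f = sym (*-zeroʳ c)
  ∑-distribˡ-* (suc m) c f =
    trans (cong (c * f 0 +_) (∑-distribˡ-* m c (f ∘ suc))) (sym (*-distribˡ-+ c (f 0) _))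

  ∑-snoc : ∀ m (f : ℕ → ℕ) → ∑< (suc m) f ≡ ∑< m f + f m
  ∑-snoc zero    f = +-identityʳ (f 0)
  ∑-snoc (suc m) f = trans (cong (f 0 +_) (∑-snoc m (f ∘ suc))) (sym (+-assoc (f 0) _ _))

  δ : ℕ → ℕ → ℕ
  δ zero    zero    = 1
  δ zero    (suc n) = 0
  δ (suc m) zero    = 0
  δ (suc m) (suc n) = δ m n

  ∑-δ : ∀ m N (f : ℕ → ℕ) → m < N → ∑[ k < N ] f k * δ m k ≡ f m
  ∑-δ zero    (suc N) f _ = begin
    f 0 * 1 + (∑[ k < N ] f (suc k) * 0) ≡⟨ cong₂ _+_ (*-identityʳ (f 0)) (∑-cong N (λ k → *-zeroʳ (f (suc k)))) ⟩
    f 0 + (∑[ k < N ] 0)                ≡⟨ cong (f 0 +_) (∑-zero N) ⟩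
    f 0 + 0                             ≡⟨ +-identityʳ (f 0) ⟩
    f 0                                 ∎
  ∑-δ (suc m) (suc N) f (s≤s m<N) =
    trans (cong (_+ (∑[ k < N ] f (suc k) * δ m k)) (*-zeroʳ (f 0))) (∑-δ m N (f ∘ suc) m<N)

  -- Pascal's rule as the definition, so that binomial sums split by computation.
  binom : ℕ → ℕ → ℕ
  binom n       zero    = 1
  binom zero    (suc k) = 0
  binom (suc n) (suc k) = binom n k + binom n (suc k)

  binom≡C : ∀ n k → binom n k ≡ n C k
  binom≡C n       zero    = sym (trans (nCk≡nC[n∸k] {0} {n} z≤n) (nCn≡1 n))
  binom≡C zero    (suc k) = refl
  binom≡C (suc n) (suc k) =
    trans (cong₂ _+_ (binom≡C n k) (binom≡C n (suc k))) (nCk+nC[k+1]≡[n+1]C[k+1] n k)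

  n<k⇒binom≡0 : ∀ {n k} → n < k → binom n k ≡ 0
  n<k⇒binom≡0 {zero}  {suc k} _          = refl
  n<k⇒binom≡0 {suc n} {suc k} (s≤s n<k) =
    cong₂ _+_ (n<k⇒binom≡0 n<k) (n<k⇒binom≡0 (m<n⇒m<1+n n<k))

  binom-1 : ∀ n → binom n 1 ≡ n
  binom-1 zero    = refl
  binom-1 (suc n) = cong suc (binom-1 n)

  binom-absorb : ∀ n k → suc k * binom (suc n) (suc k) ≡ suc n * binom n k
  binom-absorb zero    zero    = refl
  binom-absorb zero    (suc k) = *-zeroʳ (2 + k)
  binom-absorb (suc n) zero    = trans (+-identityʳ _) (trans (binom-1 (2 + n)) (sym (*-identityʳ _)))
  binom-absorb (suc n) (suc k) = begin
    (2 + k) * (b + c)              ≡⟨ lemma k b c ⟩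
    (1 + k) * b + b + (2 + k) * c  ≡⟨ cong₂ (λ x y → x + b + y) (binom-absorb n k) (binom-absorb n (suc k)) ⟩
    (1 + n) * binom n k + b + (1 + n) * binom n (suc k) ≡⟨ lemma′ n (binom n k) (binom n (suc k)) ⟩
    (2 + n) * b                    ∎
    where
    b = binom (suc n) (suc k)
    c = binom (suc n) (2 + k)
    lemma : ∀ k b c → (2 + k) * (b + c) ≡ (1 + k) * b + b + (2 + k) * c
    lemma = solve-∀
    lemma′ : ∀ n x y → (1 + n) * x + (x + y) + (1 + n) * y ≡ (2 + n) * (x + y)
    lemma′ = solve-∀

  binom-absorb-∸ : ∀ n k → (suc n ∸ k) * binom (suc n) k ≡ suc n * binom n k
  binom-absorb-∸ n k = begin
    (suc n ∸ k) * b          ≡⟨ *-distribʳ-∸ b (suc n) k ⟩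
    suc n * b ∸ k * b        ≡⟨ cong (_∸ k * b) (split k) ⟩
    suc n * binom n k + k * b ∸ k * b ≡⟨ m+n∸n≡m (suc n * binom n k) (k * b) ⟩
    suc n * binom n k        ∎
    where
    b = binom (suc n) k
    split : ∀ k → suc n * binom (suc n) k ≡ suc n * binom n k + k * binom (suc n) k
    split zero    = sym (+-identityʳ _)
    split (suc k) = begin
      suc n * (binom n k + binom n (suc k))           ≡⟨ *-distribˡ-+ (suc n) (binom n k) _ ⟩
      suc n * binom n k + suc n * binom n (suc k)      ≡⟨ +-comm (suc n * binom n k) _ ⟩
      suc n * binom n (suc k) + suc n * binom n k      ≡⟨ cong (suc n * binom n (suc k) +_) (binom-absorb n k) ⟨
      suc n * binom n (suc k) + suc k * binom (suc n) (suc k) ∎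

  -- 2n, in a form whose parity is visible to pattern matching.
  double : ℕ → ℕ
  double zero    = 0
  double (suc n) = suc (suc (double n))

  double≡n+n : ∀ n → double n ≡ n + n
  double≡n+n zero    = refl
  double≡n+n (suc n) = cong suc (trans (cong suc (double≡n+n n)) (sym (+-suc n n)))

  momentTerm : ℕ → ℕ → ℕ → ℕ
  momentTerm r n k = binom n k * ∣ n - double k ∣ ^ r

  -- 2^r U_r(n): doubling the distances |n/2 − k| keeps them in ℕ.
  moment : ℕ → ℕ → ℕ
  moment r n = ∑< (suc n) (momentTerm r n)

  ∑binom-pad : ∀ e n (g : ℕ → ℕ) → ∑[ k < e + suc n ] binom n k * g k ≡ ∑[ k < suc n ] binom n k * g k
  ∑binom-pad zero    n g = refl
  ∑binom-pad (suc e) n g = begin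
    ∑[ k < suc (e + suc n) ] binom n k * g k           ≡⟨ ∑-snoc (e + suc n) _ ⟩
    (∑[ k < e + suc n ] binom n k * g k) + binom n (e + suc n) * g (e + suc n)
      ≡⟨ cong (λ b → (∑[ k < e + suc n ] binom n k * g k) + b * g (e + suc n)) (n<k⇒binom≡0 (m≤n+m (suc n) e)) ⟩
    (∑[ k < e + suc n ] binom n k * g k) + 0            ≡⟨ +-identityʳ _ ⟩
    ∑[ k < e + suc n ] binom n k * g k                  ≡⟨ ∑binom-pad e n g ⟩
    ∑[ k < suc n ] binom n k * g k                      ∎

  ∑binom-pascal : ∀ n (g : ℕ → ℕ) →
    ∑[ k < 2 + n ] binom (suc n) k * g k ≡ (∑[ k < suc n ] binom n k * g k) + (∑[ k < suc n ] binom n k * g (suc k))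
  ∑binom-pascal n g = begin
    1 * g 0 + (∑[ k < suc n ] (binom n k + binom n (suc k)) * g (suc k))
      ≡⟨ cong (1 * g 0 +_) (trans (∑-cong (suc n) (λ k → *-distribʳ-+ (g (suc k)) (binom n k) (binom n (suc k))))
                                  (∑-distrib-+ (suc n) shifted upper)) ⟩
    1 * g 0 + (∑< (suc n) shifted + ∑< (suc n) upper)   ≡⟨ x∙yz≈y∙xz (1 * g 0) (∑< (suc n) shifted) _ ⟩
    ∑< (suc n) shifted + (1 * g 0 + ∑< (suc n) upper)   ≡⟨ cong (∑< (suc n) shifted +_) (∑binom-pad 1 n g) ⟩
    ∑< (suc n) shifted + (∑[ k < suc n ] binom n k * g k) ≡⟨ +-comm (∑< (suc n) shifted) _ ⟩
    (∑[ k < suc n ] binom n k * g k) + ∑< (suc n) shifted ∎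
    where
    shifted upper : ℕ → ℕ
    shifted k = binom n k * g (suc k)
    upper   k = binom n (suc k) * g (suc k)

  moment-0 : ∀ n → moment 0 n ≡ 2 ^ n
  moment-0 zero    = refl
  moment-0 (suc n) = begin
    moment 0 (suc n)          ≡⟨ ∑binom-pascal n (λ _ → 1) ⟩
    moment 0 n + moment 0 n   ≡⟨ cong₂ _+_ (moment-0 n) (moment-0 n) ⟩
    2 ^ n + 2 ^ n             ≡⟨ cong (2 ^ n +_) (+-identityʳ (2 ^ n)) ⟨
    2 ^ suc n                 ∎

  ∣m-n∣²+4mn≡[m+n]² : ∀ m n → ∣ m - n ∣ * ∣ m - n ∣ + 4 * (m * n) ≡ (m + n) * (m + n)
  ∣m-n∣²+4mn≡[m+n]² zero    n       = +-identityʳ (n * n)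
  ∣m-n∣²+4mn≡[m+n]² (suc m) zero    = lemma m
    where
    lemma : ∀ m → suc m * suc m + 4 * (suc m * 0) ≡ (suc m + 0) * (suc m + 0)
    lemma = solve-∀
  ∣m-n∣²+4mn≡[m+n]² (suc m) (suc n) = begin
    d * d + 4 * (suc m * suc n)          ≡⟨ lemma d m n ⟩
    d * d + 4 * (m * n) + 4 * (m + n + 1) ≡⟨ cong (_+ 4 * (m + n + 1)) (∣m-n∣²+4mn≡[m+n]² m n) ⟩
    (m + n) * (m + n) + 4 * (m + n + 1)   ≡⟨ lemma′ m n ⟩
    (suc m + suc n) * (suc m + suc n)     ∎
    where
    d = ∣ m - n ∣
    lemma : ∀ d m n → d * d + 4 * (suc m * suc n) ≡ d * d + 4 * (m * n) + 4 * (m + n + 1)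
    lemma = solve-∀
    lemma′ : ∀ m n → (m + n) * (m + n) + 4 * (m + n + 1) ≡ (suc m + suc n) * (suc m + suc n)
    lemma′ = solve-∀

  ∣n-2k∣²+4k[n∸k]≡n² : ∀ n k → k ≤ n → ∣ n - double k ∣ * ∣ n - double k ∣ + 4 * (k * (n ∸ k)) ≡ n * n
  ∣n-2k∣²+4k[n∸k]≡n² n k k≤n = begin
    ∣ n - double k ∣ * ∣ n - double k ∣ + 4 * (k * (n ∸ k)) ≡⟨ cong (λ d → d * d + 4 * (k * (n ∸ k))) ∣n-2k∣≡∣k-[n∸k]∣ ⟩
    ∣ k - n ∸ k ∣ * ∣ k - n ∸ k ∣ + 4 * (k * (n ∸ k))     ≡⟨ ∣m-n∣²+4mn≡[m+n]² k (n ∸ k) ⟩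
    (k + (n ∸ k)) * (k + (n ∸ k))                         ≡⟨ cong (λ x → x * x) (m+[n∸m]≡n k≤n) ⟩
    n * n                                                 ∎
    where
    ∣n-2k∣≡∣k-[n∸k]∣ : ∣ n - double k ∣ ≡ ∣ k - n ∸ k ∣
    ∣n-2k∣≡∣k-[n∸k]∣ = begin
      ∣ n - double k ∣           ≡⟨ cong₂ ∣_-_∣ (sym (m+[n∸m]≡n k≤n)) (double≡n+n k) ⟩
      ∣ k + (n ∸ k) - k + k ∣    ≡⟨ ∣m+n-m+o∣≡∣n-o∣ k (n ∸ k) k ⟩
      ∣ n ∸ k - k ∣              ≡⟨ ∣-∣-comm (n ∸ k) k ⟩
      ∣ k - n ∸ k ∣              ∎

  momentTerm-recurrence : ∀ r n k →
    momentTerm (2 + r) n k + 4 * (k * (n ∸ k) * momentTerm r n k) ≡ n * n * momentTerm r n k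
  momentTerm-recurrence r n k with k ≤? n
  ... | yes k≤n = begin
    b * (d * (d * d ^ r)) + 4 * (k * (n ∸ k) * (b * d ^ r)) ≡⟨ lemma b d (d ^ r) k (n ∸ k) ⟩
    (d * d + 4 * (k * (n ∸ k))) * (b * d ^ r)               ≡⟨ cong (_* (b * d ^ r)) (∣n-2k∣²+4k[n∸k]≡n² n k k≤n) ⟩
    n * n * (b * d ^ r)                                     ∎
    where
    b = binom n k
    d = ∣ n - double k ∣
    lemma : ∀ b d e k l → b * (d * (d * e)) + 4 * (k * l * (b * e)) ≡ (d * d + 4 * (k * l)) * (b * e)
    lemma = solve-∀
  ... | no k≰n rewrite n<k⇒binom≡0 (≰⇒> k≰n) =
    trans (cong (4 *_) (*-zeroʳ (k * (n ∸ k)))) (sym (*-zeroʳ (n * n)))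

  ∑momentTerm-recurrence : ∀ r n →
    moment (2 + r) n + 4 * (∑[ k < suc n ] k * (n ∸ k) * momentTerm r n k) ≡ n * n * moment r n
  ∑momentTerm-recurrence r n = begin
    moment (2 + r) n + 4 * ∑< (suc n) weighted          ≡⟨ cong (moment (2 + r) n +_) (∑-distribˡ-* (suc n) 4 weighted) ⟨
    moment (2 + r) n + ∑< (suc n) (λ k → 4 * weighted k)
      ≡⟨ ∑-distrib-+ (suc n) (momentTerm (2 + r) n) (λ k → 4 * weighted k) ⟨
    ∑[ k < suc n ] (momentTerm (2 + r) n k + 4 * weighted k) ≡⟨ ∑-cong (suc n) (momentTerm-recurrence r n) ⟩
    ∑[ k < suc n ] n * n * momentTerm r n k              ≡⟨ ∑-distribˡ-* (suc n) (n * n) (momentTerm r n) ⟩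
    n * n * moment r n                                   ∎
    where
    weighted : ℕ → ℕ
    weighted k = k * (n ∸ k) * momentTerm r n k

  -- k (N - k) C(N, k) = N (N - 1) C(N - 2, k - 1), and |N - 2k| is unchanged under (N, k) ↦ (N - 2, k - 1).
  ∑weighted-reindex : ∀ r n →
    ∑[ k < 3 + n ] k * (2 + n ∸ k) * momentTerm r (2 + n) k ≡ (2 + n) * (1 + n) * moment r n
  ∑weighted-reindex r n = begin
    ∑[ k < 2 + n ] suc k * (suc n ∸ k) * momentTerm r (2 + n) (suc k) ≡⟨ ∑-cong (2 + n) reindex ⟩
    ∑[ k < 2 + n ] (2 + n) * (1 + n) * momentTerm r n k ≡⟨ ∑-distribˡ-* (2 + n) ((2 + n) * (1 + n)) (momentTerm r n) ⟩
    (2 + n) * (1 + n) * ∑< (2 + n) (momentTerm r n)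
      ≡⟨ cong ((2 + n) * (1 + n) *_) (∑binom-pad 1 n (λ k → ∣ n - double k ∣ ^ r)) ⟩
    (2 + n) * (1 + n) * moment r n                      ∎
    where
    reindex : ∀ k → suc k * (suc n ∸ k) * momentTerm r (2 + n) (suc k) ≡ (2 + n) * (1 + n) * momentTerm r n k
    reindex k = begin
      suc k * (suc n ∸ k) * (binom (2 + n) (suc k) * e)   ≡⟨ lemma (suc k) (suc n ∸ k) (binom (2 + n) (suc k)) e ⟩
      suc k * binom (2 + n) (suc k) * (suc n ∸ k) * e     ≡⟨ cong (λ x → x * (suc n ∸ k) * e) (binom-absorb (suc n) k) ⟩
      (2 + n) * binom (1 + n) k * (suc n ∸ k) * e         ≡⟨ lemma′ (2 + n) (binom (1 + n) k) (suc n ∸ k) e ⟩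
      (2 + n) * ((suc n ∸ k) * binom (1 + n) k) * e       ≡⟨ cong (λ x → (2 + n) * x * e) (binom-absorb-∸ n k) ⟩
      (2 + n) * ((1 + n) * binom n k) * e                 ≡⟨ lemma″ (2 + n) (1 + n) (binom n k) e ⟩
      (2 + n) * (1 + n) * (binom n k * e)                 ∎
      where
      e = ∣ n - double k ∣ ^ r
      lemma : ∀ a b c e → a * b * (c * e) ≡ a * c * b * e
      lemma = solve-∀
      lemma′ : ∀ a c b e → a * c * b * e ≡ a * (b * c) * e
      lemma′ = solve-∀
      lemma″ : ∀ a b c e → a * (b * c) * e ≡ a * b * (c * e)
      lemma″ = solve-∀

  moment-recurrence : ∀ r n →
    moment (2 + r) (2 + n) + 4 * ((2 + n) * (1 + n)) * moment r n ≡ (2 + n) * (2 + n) * moment r (2 + n)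
  moment-recurrence r n = begin
    moment (2 + r) (2 + n) + 4 * ((2 + n) * (1 + n)) * moment r n
      ≡⟨ cong (moment (2 + r) (2 + n) +_) (*-assoc 4 ((2 + n) * (1 + n)) (moment r n)) ⟩
    moment (2 + r) (2 + n) + 4 * ((2 + n) * (1 + n) * moment r n)
      ≡⟨ cong (λ x → moment (2 + r) (2 + n) + 4 * x) (∑weighted-reindex r n) ⟨
    moment (2 + r) (2 + n) + 4 * (∑[ k < 3 + n ] k * (2 + n ∸ k) * momentTerm r (2 + n) k)
      ≡⟨ ∑momentTerm-recurrence r (2 + n) ⟩
    (2 + n) * (2 + n) * moment r (2 + n) ∎

  ∣1+m-n∣+∣m-1+n∣ : ∀ m n → ∣ suc m - n ∣ + ∣ m - suc n ∣ ≡ 2 * ∣ m - n ∣ + 2 * δ m n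
  ∣1+m-n∣+∣m-1+n∣ zero    zero    = refl
  ∣1+m-n∣+∣m-1+n∣ zero    (suc n) = lemma n
    where
    lemma : ∀ n → n + suc (suc n) ≡ 2 * suc n + 2 * 0
    lemma = solve-∀
  ∣1+m-n∣+∣m-1+n∣ (suc m) zero    = trans (cong (suc (suc m) +_) (∣-∣-identityʳ m)) (lemma m)
    where
    lemma : ∀ m → suc (suc m) + m ≡ 2 * suc m + 2 * 0
    lemma = solve-∀
  ∣1+m-n∣+∣m-1+n∣ (suc m) (suc n) = ∣1+m-n∣+∣m-1+n∣ m n

  centralTerm : ℕ → ℕ
  centralTerm n = ∑[ k < suc n ] binom n k * δ n (double k)

  moment-1-suc : ∀ n → moment 1 (suc n) ≡ 2 * moment 1 n + 2 * centralTerm n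
  moment-1-suc n = begin
    moment 1 (suc n)
      ≡⟨ ∑binom-pascal n (λ k → ∣ suc n - double k ∣ ^ 1) ⟩
    (∑[ k < suc n ] binom n k * ∣ suc n - double k ∣ ^ 1) + (∑[ k < suc n ] binom n k * ∣ n - suc (double k) ∣ ^ 1)
      ≡⟨ ∑-distrib-+ (suc n) (λ k → binom n k * ∣ suc n - double k ∣ ^ 1) (λ k → binom n k * ∣ n - suc (double k) ∣ ^ 1) ⟨
    ∑[ k < suc n ] (binom n k * ∣ suc n - double k ∣ ^ 1 + binom n k * ∣ n - suc (double k) ∣ ^ 1)
      ≡⟨ ∑-cong (suc n) pointwise ⟩
    ∑[ k < suc n ] (2 * momentTerm 1 n k + 2 * (binom n k * δ n (double k)))
      ≡⟨ ∑-distrib-+ (suc n) (λ k → 2 * momentTerm 1 n k) (λ k → 2 * (binom n k * δ n (double k))) ⟩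
    (∑[ k < suc n ] 2 * momentTerm 1 n k) + (∑[ k < suc n ] 2 * (binom n k * δ n (double k)))
      ≡⟨ cong₂ _+_ (∑-distribˡ-* (suc n) 2 (momentTerm 1 n)) (∑-distribˡ-* (suc n) 2 (λ k → binom n k * δ n (double k))) ⟩
    2 * moment 1 n + 2 * centralTerm n ∎
    where
    pointwise : ∀ k → binom n k * ∣ suc n - double k ∣ ^ 1 + binom n k * ∣ n - suc (double k) ∣ ^ 1
                    ≡ 2 * momentTerm 1 n k + 2 * (binom n k * δ n (double k))
    pointwise k = begin
      b * (x * 1) + b * (y * 1)          ≡⟨ lemma b x y ⟩
      b * (x + y)                        ≡⟨ cong (b *_) (∣1+m-n∣+∣m-1+n∣ n (double k)) ⟩
      b * (2 * d + 2 * δ n (double k))   ≡⟨ lemma′ b d (δ n (double k)) ⟩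
      2 * (b * (d * 1)) + 2 * (b * δ n (double k)) ∎
      where
      b = binom n k
      x = ∣ suc n - double k ∣
      y = ∣ n - suc (double k) ∣
      d = ∣ n - double k ∣
      lemma : ∀ b x y → b * (x * 1) + b * (y * 1) ≡ b * (x + y)
      lemma = solve-∀
      lemma′ : ∀ b d e → b * (2 * d + 2 * e) ≡ 2 * (b * (d * 1)) + 2 * (b * e)
      lemma′ = solve-∀

  centralTerm-even : ∀ m → centralTerm (double m) ≡ binom (double m) m
  centralTerm-even m = trans (∑-cong (suc (double m)) (λ k → cong (binom (double m) k *_) (δ-double m k)))
                             (∑-δ m (suc (double m)) (binom (double m)) (s≤s m≤2m))
    where
    δ-double : ∀ m k → δ (double m) (double k) ≡ δ m k
    δ-double zero    zero    = refl
    δ-double zero    (suc k) = refl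
    δ-double (suc m) zero    = refl
    δ-double (suc m) (suc k) = δ-double m k
    m≤2m : m ≤ double m
    m≤2m = subst (m ≤_) (sym (double≡n+n m)) (m≤m+n m m)

  centralTerm-odd : ∀ m → centralTerm (suc (double m)) ≡ 0
  centralTerm-odd m = trans (∑-cong (2 + double m) vanishes) (∑-zero (2 + double m))
    where
    δ-odd : ∀ m k → δ (suc (double m)) (double k) ≡ 0
    δ-odd zero    zero    = refl
    δ-odd zero    (suc k) = refl
    δ-odd (suc m) zero    = refl
    δ-odd (suc m) (suc k) = δ-odd m k
    vanishes : ∀ k → binom (suc (double m)) k * δ (suc (double m)) (double k) ≡ 0
    vanishes k = trans (cong (binom (suc (double m)) k *_) (δ-odd m k)) (*-zeroʳ (binom (suc (double m)) k))

  central-binom-suc : ∀ m → suc m * binom (double (suc m)) (suc m) ≡ 2 * (suc (double m) * binom (double m) m)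
  central-binom-suc m = *-cancelˡ-≡ _ _ (suc m) (begin
    suc m * (suc m * binom (2 + double m) (suc m))   ≡⟨ cong (suc m *_) (binom-absorb (suc (double m)) m) ⟩
    suc m * ((2 + double m) * binom (1 + double m) m) ≡⟨ lemma (suc m) (2 + double m) (binom (1 + double m) m) ⟩
    (2 + double m) * (suc m * binom (1 + double m) m)
      ≡⟨ cong (λ x → (2 + double m) * (x * binom (1 + double m) m)) 1+2m∸m≡1+m ⟨
    (2 + double m) * ((suc (double m) ∸ m) * binom (1 + double m) m)
      ≡⟨ cong ((2 + double m) *_) (binom-absorb-∸ (double m) m) ⟩
    (2 + double m) * (suc (double m) * c)             ≡⟨ cong (λ x → (2 + x) * (suc x * c)) (double≡n+n m) ⟩
    (2 + (m + m)) * (suc (m + m) * c)                 ≡⟨ lemma′ m c ⟩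
    suc m * (2 * (suc (m + m) * c))                   ≡⟨ cong (λ x → suc m * (2 * (suc x * c))) (double≡n+n m) ⟨
    suc m * (2 * (suc (double m) * c))                ∎)
    where
    c = binom (double m) m
    1+2m∸m≡1+m : suc (double m) ∸ m ≡ suc m
    1+2m∸m≡1+m = trans (cong (λ x → suc x ∸ m) (double≡n+n m)) (m+n∸n≡m (suc m) m)
    lemma : ∀ a b c → a * (b * c) ≡ b * (a * c)
    lemma = solve-∀
    lemma′ : ∀ m c → (2 + (m + m)) * (suc (m + m) * c) ≡ suc m * (2 * (suc (m + m) * c))
    lemma′ = solve-∀

  moment-1-even : ∀ m → moment 1 (double m) ≡ double m * binom (double m) m
  moment-1-odd  : ∀ m → moment 1 (suc (double m)) ≡ suc m * binom (double (suc m)) (suc m)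

  moment-1-even zero    = refl
  moment-1-even (suc m) = begin
    moment 1 (2 + double m)                                  ≡⟨ moment-1-suc (suc (double m)) ⟩
    2 * moment 1 (1 + double m) + 2 * centralTerm (1 + double m)
      ≡⟨ cong₂ (λ x y → 2 * x + 2 * y) (moment-1-odd m) (centralTerm-odd m) ⟩
    2 * (suc m * c) + 2 * 0                                   ≡⟨ lemma m c ⟩
    (2 + (m + m)) * c                                         ≡⟨ cong (λ x → (2 + x) * c) (double≡n+n m) ⟨
    (2 + double m) * c                                        ∎
    where
    c = binom (double (suc m)) (suc m)
    lemma : ∀ m c → 2 * (suc m * c) + 2 * 0 ≡ (2 + (m + m)) * c
    lemma = solve-∀
  moment-1-odd m = begin
    moment 1 (suc (double m))                         ≡⟨ moment-1-suc (double m) ⟩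
    2 * moment 1 (double m) + 2 * centralTerm (double m)
      ≡⟨ cong₂ (λ x y → 2 * x + 2 * y) (moment-1-even m) (centralTerm-even m) ⟩
    2 * (double m * c) + 2 * c                        ≡⟨ lemma (double m) c ⟩
    2 * (suc (double m) * c)                          ≡⟨ central-binom-suc m ⟨
    suc m * binom (double (suc m)) (suc m)            ∎
    where
    c = binom (double m) m
    lemma : ∀ d c → 2 * (d * c) + 2 * c ≡ 2 * (suc d * c)
    lemma = solve-∀

module Polynomials where

  open import Data.Nat as ℕ using (ℕ; zero; suc)
  open import Data.Integer as ℤ using (ℤ; +_; +[1+_]; _+_; _*_; -_; _-_)
  open import Data.Integer.Properties as ℤ using (pos-*)
  open import Data.Integer.Tactic.RingSolver using (solve-∀)
  open import Data.Vec using (Vec; []; _∷_; toList; zipWith; map)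
  open import Data.Vec.Properties using (length-toList)
  open import Defs using (eval; lastCoeff; HasDegree)
  open import Data.Product using (∃; _,_)
  open import Relation.Binary.PropositionalEquality
  open ≡-Reasoning

  ⟦_⟧ : ∀ {n} → Vec ℤ n → ℤ → ℤ
  ⟦ p ⟧ x = eval (toList p) x

  lead : ∀ {n} → Vec ℤ n → ℤ
  lead p = lastCoeff (toList p)

  infixl 6 _⊕_
  infixr 7 _⊛_

  _⊕_ : ∀ {n} → Vec ℤ n → Vec ℤ n → Vec ℤ n
  _⊕_ = zipWith _+_

  _⊛_ : ∀ {n} → ℤ → Vec ℤ n → Vec ℤ n
  c ⊛ p = map (c *_) p

  shift : ∀ {n} → Vec ℤ n → Vec ℤ (suc n)
  shift p = + 0 ∷ p

  pad : ∀ {n} → Vec ℤ n → Vec ℤ (suc n)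
  pad []      = + 0 ∷ []
  pad (a ∷ p) = a ∷ pad p

  ⟦⊕⟧ : ∀ {n} (p q : Vec ℤ n) x → ⟦ p ⊕ q ⟧ x ≡ ⟦ p ⟧ x + ⟦ q ⟧ x
  ⟦⊕⟧ []      []      x = refl
  ⟦⊕⟧ (a ∷ p) (b ∷ q) x = begin
    a + b + x * ⟦ p ⊕ q ⟧ x          ≡⟨ cong (λ y → a + b + x * y) (⟦⊕⟧ p q x) ⟩
    a + b + x * (⟦ p ⟧ x + ⟦ q ⟧ x)  ≡⟨ lemma a b x (⟦ p ⟧ x) (⟦ q ⟧ x) ⟩
    a + x * ⟦ p ⟧ x + (b + x * ⟦ q ⟧ x) ∎
    where
    lemma : ∀ a b x u v → a + b + x * (u + v) ≡ a + x * u + (b + x * v)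
    lemma = solve-∀

  ⟦⊛⟧ : ∀ {n} c (p : Vec ℤ n) x → ⟦ c ⊛ p ⟧ x ≡ c * ⟦ p ⟧ x
  ⟦⊛⟧ c []      x = sym (ℤ.*-zeroʳ c)
  ⟦⊛⟧ c (a ∷ p) x = begin
    c * a + x * ⟦ c ⊛ p ⟧ x   ≡⟨ cong (λ y → c * a + x * y) (⟦⊛⟧ c p x) ⟩
    c * a + x * (c * ⟦ p ⟧ x) ≡⟨ lemma c a x (⟦ p ⟧ x) ⟩
    c * (a + x * ⟦ p ⟧ x)     ∎
    where
    lemma : ∀ c a x u → c * a + x * (c * u) ≡ c * (a + x * u)
    lemma = solve-∀

  ⟦shift⟧ : ∀ {n} (p : Vec ℤ n) x → ⟦ shift p ⟧ x ≡ x * ⟦ p ⟧ x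
  ⟦shift⟧ p x = ℤ.+-identityˡ (x * ⟦ p ⟧ x)

  ⟦pad⟧ : ∀ {n} (p : Vec ℤ n) x → ⟦ pad p ⟧ x ≡ ⟦ p ⟧ x
  ⟦pad⟧ []      x = trans (ℤ.+-identityˡ (x * + 0)) (ℤ.*-zeroʳ x)
  ⟦pad⟧ (a ∷ p) x = cong (λ y → a + x * y) (⟦pad⟧ p x)

  ⟦constant⟧ : ∀ c x → ⟦ c ∷ [] ⟧ x ≡ c
  ⟦constant⟧ c x = trans (cong (λ y → c + y) (ℤ.*-zeroʳ x)) (ℤ.+-identityʳ c)

  lead-⊕ : ∀ {n} (p q : Vec ℤ n) → lead (p ⊕ q) ≡ lead p + lead q
  lead-⊕ []          []          = refl
  lead-⊕ (a ∷ [])    (b ∷ [])    = refl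
  lead-⊕ (a ∷ a′ ∷ p) (b ∷ b′ ∷ q) = lead-⊕ (a′ ∷ p) (b′ ∷ q)

  lead-⊛ : ∀ {n} c (p : Vec ℤ n) → lead (c ⊛ p) ≡ c * lead p
  lead-⊛ c []         = sym (ℤ.*-zeroʳ c)
  lead-⊛ c (a ∷ [])   = refl
  lead-⊛ c (a ∷ b ∷ p) = lead-⊛ c (b ∷ p)

  lead-shift : ∀ {n} (p : Vec ℤ n) → lead (shift p) ≡ lead p
  lead-shift []      = refl
  lead-shift (a ∷ p) = refl

  lead-pad : ∀ {n} (p : Vec ℤ n) → lead (pad p) ≡ + 0
  lead-pad []         = refl
  lead-pad (a ∷ [])   = refl
  lead-pad (a ∷ b ∷ p) = lead-pad (b ∷ p)

  linear : ∀ {n} → ℤ → ℤ → Vec ℤ n → Vec ℤ (suc n)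
  linear a b p = a ⊛ shift p ⊕ b ⊛ pad p

  ⟦linear⟧ : ∀ {n} a b (p : Vec ℤ n) x → ⟦ linear a b p ⟧ x ≡ (a * x + b) * ⟦ p ⟧ x
  ⟦linear⟧ a b p x = begin
    ⟦ a ⊛ shift p ⊕ b ⊛ pad p ⟧ x              ≡⟨ ⟦⊕⟧ (a ⊛ shift p) (b ⊛ pad p) x ⟩
    ⟦ a ⊛ shift p ⟧ x + ⟦ b ⊛ pad p ⟧ x        ≡⟨ cong₂ _+_ (⟦⊛⟧ a (shift p) x) (⟦⊛⟧ b (pad p) x) ⟩
    a * ⟦ shift p ⟧ x + b * ⟦ pad p ⟧ x        ≡⟨ cong₂ (λ u v → a * u + b * v) (⟦shift⟧ p x) (⟦pad⟧ p x) ⟩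
    a * (x * ⟦ p ⟧ x) + b * ⟦ p ⟧ x            ≡⟨ lemma a b x (⟦ p ⟧ x) ⟩
    (a * x + b) * ⟦ p ⟧ x                      ∎
    where
    lemma : ∀ a b x u → a * (x * u) + b * u ≡ (a * x + b) * u
    lemma = solve-∀

  lead-linear : ∀ {n} a b (p : Vec ℤ n) → lead (linear a b p) ≡ a * lead p
  lead-linear a b p = begin
    lead (a ⊛ shift p ⊕ b ⊛ pad p)         ≡⟨ lead-⊕ (a ⊛ shift p) (b ⊛ pad p) ⟩
    lead (a ⊛ shift p) + lead (b ⊛ pad p)  ≡⟨ cong₂ _+_ (lead-⊛ a (shift p)) (lead-⊛ b (pad p)) ⟩
    a * lead (shift p) + b * lead (pad p)  ≡⟨ cong₂ (λ u v → a * u + b * v) (lead-shift p) (lead-pad p) ⟩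
    a * lead p + b * + 0                   ≡⟨ lemma a b (lead p) ⟩
    a * lead p                             ∎
    where
    lemma : ∀ a b l → a * l + b * + 0 ≡ a * l
    lemma = solve-∀

  -- Δ(a + x q) = q + (x − 1) Δq
  Δ : ∀ {n} → Vec ℤ (suc n) → Vec ℤ n
  Δ (a ∷ [])    = []
  Δ (a ∷ b ∷ q) = (b ∷ q) ⊕ linear (+ 1) (- + 1) (Δ (b ∷ q))

  ⟦Δ⟧ : ∀ {n} (p : Vec ℤ (suc n)) x → ⟦ Δ p ⟧ x ≡ ⟦ p ⟧ x - ⟦ p ⟧ (x - + 1)
  ⟦Δ⟧ (a ∷ [])    x = lemma a x
    where
    lemma : ∀ a x → + 0 ≡ a + x * + 0 - (a + (x - + 1) * + 0)
    lemma = solve-∀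
  ⟦Δ⟧ (a ∷ b ∷ q) x = begin
    ⟦ (b ∷ q) ⊕ linear (+ 1) (- + 1) (Δ (b ∷ q)) ⟧ x ≡⟨ ⟦⊕⟧ (b ∷ q) (linear (+ 1) (- + 1) (Δ (b ∷ q))) x ⟩
    u + ⟦ linear (+ 1) (- + 1) (Δ (b ∷ q)) ⟧ x     ≡⟨ cong (λ y → u + y) (⟦linear⟧ (+ 1) (- + 1) (Δ (b ∷ q)) x) ⟩
    u + (+ 1 * x + - + 1) * ⟦ Δ (b ∷ q) ⟧ x        ≡⟨ cong (λ d → u + (+ 1 * x + - + 1) * d) (⟦Δ⟧ (b ∷ q) x) ⟩
    u + (+ 1 * x + - + 1) * (u - v)                ≡⟨ lemma a x u v ⟩
    a + x * u - (a + (x - + 1) * v)                ∎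
    where
    u = ⟦ b ∷ q ⟧ x
    v = ⟦ b ∷ q ⟧ (x - + 1)
    lemma : ∀ a x u v → u + (+ 1 * x + - + 1) * (u - v) ≡ a + x * u - (a + (x - + 1) * v)
    lemma = solve-∀

  lead-Δ : ∀ {n} (p : Vec ℤ (suc n)) → lead (Δ p) ≡ + n * lead p
  lead-Δ (a ∷ [])            = refl
  lead-Δ {suc n} (a ∷ b ∷ q) = begin
    lead ((b ∷ q) ⊕ linear (+ 1) (- + 1) (Δ (b ∷ q))) ≡⟨ lead-⊕ (b ∷ q) (linear (+ 1) (- + 1) (Δ (b ∷ q))) ⟩
    l + lead (linear (+ 1) (- + 1) (Δ (b ∷ q)))       ≡⟨ cong (λ y → l + y) (lead-linear (+ 1) (- + 1) (Δ (b ∷ q))) ⟩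
    l + + 1 * lead (Δ (b ∷ q))                         ≡⟨ cong (λ d → l + + 1 * d) (lead-Δ (b ∷ q)) ⟩
    l + + 1 * (+ n * l)                                ≡⟨ lemma (+ n) l ⟩
    (+ 1 + + n) * l                                    ∎
    where
    l = lead (b ∷ q)
    lemma : ∀ n l → l + + 1 * (n * l) ≡ (+ 1 + n) * l
    lemma = solve-∀

  quadratic : ∀ {n} → ℤ → ℤ → ℤ → Vec ℤ n → Vec ℤ (suc (suc n))
  quadratic g h k p = shift (linear g h p) ⊕ k ⊛ pad (pad p)

  ⟦quadratic⟧ : ∀ {n} g h k (p : Vec ℤ n) x → ⟦ quadratic g h k p ⟧ x ≡ (g * x * x + h * x + k) * ⟦ p ⟧ x
  ⟦quadratic⟧ g h k p x = begin
    ⟦ shift (linear g h p) ⊕ k ⊛ pad (pad p) ⟧ x         ≡⟨ ⟦⊕⟧ (shift (linear g h p)) (k ⊛ pad (pad p)) x ⟩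
    ⟦ shift (linear g h p) ⟧ x + ⟦ k ⊛ pad (pad p) ⟧ x   ≡⟨ cong₂ _+_ (⟦shift⟧ (linear g h p) x) (⟦⊛⟧ k (pad (pad p)) x) ⟩
    x * ⟦ linear g h p ⟧ x + k * ⟦ pad (pad p) ⟧ x        ≡⟨ cong₂ (λ u v → x * u + k * v) (⟦linear⟧ g h p x)
                                                                  (trans (⟦pad⟧ (pad p) x) (⟦pad⟧ p x)) ⟩
    x * ((g * x + h) * ⟦ p ⟧ x) + k * ⟦ p ⟧ x             ≡⟨ lemma g h k x (⟦ p ⟧ x) ⟩
    (g * x * x + h * x + k) * ⟦ p ⟧ x                     ∎
    where
    lemma : ∀ g h k x u → x * ((g * x + h) * u) + k * u ≡ (g * x * x + h * x + k) * u
    lemma = solve-∀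

  lead-quadratic : ∀ {n} g h k (p : Vec ℤ n) → lead (quadratic g h k p) ≡ g * lead p
  lead-quadratic g h k p = begin
    lead (shift (linear g h p) ⊕ k ⊛ pad (pad p))       ≡⟨ lead-⊕ (shift (linear g h p)) (k ⊛ pad (pad p)) ⟩
    lead (shift (linear g h p)) + lead (k ⊛ pad (pad p)) ≡⟨ cong₂ _+_ (lead-shift (linear g h p)) (lead-⊛ k (pad (pad p))) ⟩
    lead (linear g h p) + k * lead (pad (pad p))        ≡⟨ cong₂ (λ u v → u + k * v) (lead-linear g h p) (lead-pad (pad p)) ⟩
    g * lead p + k * + 0                                 ≡⟨ lemma g k (lead p) ⟩
    g * lead p                                           ∎
    where
    lemma : ∀ g k l → g * l + k * + 0 ≡ g * l
    lemma = solve-∀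

  -- A(x) p(x) − B(x) p(x − 1) = (A − B)(x) p(x) + B(x) Δp(x); for A and B quadratic with the same
  -- leading coefficient, A − B = a x + b is linear and B = g x² + h x + k.
  step : ∀ {r} → (a b g h k : ℤ) → Vec ℤ (suc r) → Vec ℤ (suc (suc r))
  step a b g h k p = linear a b p ⊕ quadratic g h k (Δ p)

  ⟦step⟧ : ∀ {r} a b g h k (p : Vec ℤ (suc r)) x →
    ⟦ step a b g h k p ⟧ x ≡ (a * x + b) * ⟦ p ⟧ x + (g * x * x + h * x + k) * (⟦ p ⟧ x - ⟦ p ⟧ (x - + 1))
  ⟦step⟧ a b g h k p x = begin
    ⟦ linear a b p ⊕ quadratic g h k (Δ p) ⟧ x       ≡⟨ ⟦⊕⟧ (linear a b p) (quadratic g h k (Δ p)) x ⟩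
    ⟦ linear a b p ⟧ x + ⟦ quadratic g h k (Δ p) ⟧ x ≡⟨ cong₂ _+_ (⟦linear⟧ a b p x) (⟦quadratic⟧ g h k (Δ p) x) ⟩
    (a * x + b) * ⟦ p ⟧ x + (g * x * x + h * x + k) * ⟦ Δ p ⟧ x
      ≡⟨ cong (λ d → (a * x + b) * ⟦ p ⟧ x + (g * x * x + h * x + k) * d) (⟦Δ⟧ p x) ⟩
    (a * x + b) * ⟦ p ⟧ x + (g * x * x + h * x + k) * (⟦ p ⟧ x - ⟦ p ⟧ (x - + 1)) ∎

  lead-step : ∀ {r} a b g h k (p : Vec ℤ (suc r)) → lead (step a b g h k p) ≡ a * lead p + g * (+ r * lead p)
  lead-step {r} a b g h k p = begin
    lead (linear a b p ⊕ quadratic g h k (Δ p))       ≡⟨ lead-⊕ (linear a b p) (quadratic g h k (Δ p)) ⟩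
    lead (linear a b p) + lead (quadratic g h k (Δ p)) ≡⟨ cong₂ _+_ (lead-linear a b p) (lead-quadratic g h k (Δ p)) ⟩
    a * lead p + g * lead (Δ p)                        ≡⟨ cong (λ d → a * lead p + g * d) (lead-Δ p) ⟩
    a * lead p + g * (+ r * lead p)                    ∎

  family : (a b g h k : ℤ) (r : ℕ) → Vec ℤ (suc r)
  family a b g h k zero    = + 1 ∷ []
  family a b g h k (suc r) = step a b g h k (family a b g h k r)

  family-lead-positive : ∀ a b g h k r → ∃ λ l → lead (family +[1+ a ] b (+ g) h k r) ≡ +[1+ l ]
  family-lead-positive a b g h k zero    = 0 , refl
  family-lead-positive a b g h k (suc r) with family-lead-positive a b g h k r
  ... | l , lead≡ = _ , (begin
    lead (step +[1+ a ] b (+ g) h k p)            ≡⟨ lead-step +[1+ a ] b (+ g) h k p ⟩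
    +[1+ a ] * lead p + + g * (+ r * lead p)      ≡⟨ cong (λ c → +[1+ a ] * c + + g * (+ r * c)) lead≡ ⟩
    +[1+ a ] * +[1+ l ] + + g * (+ r * +[1+ l ])  ≡⟨ cong (λ c → +[1+ a ] * +[1+ l ] + c)
                                                          (trans (cong (+ g *_) (sym (pos-* r (suc l)))) (sym (pos-* g (r ℕ.* suc l)))) ⟩
    +[1+ a ] * +[1+ l ] + + (g ℕ.* (r ℕ.* suc l))  ≡⟨ cong (_+ + (g ℕ.* (r ℕ.* suc l))) (sym (pos-* (suc a) (suc l))) ⟩
    + (suc a ℕ.* suc l) + + (g ℕ.* (r ℕ.* suc l))  ∎)
    where
    p = family +[1+ a ] b (+ g) h k r

  family-hasDegree : ∀ a b g h k r → HasDegree (toList (family +[1+ a ] b (+ g) h k r)) r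
  family-hasDegree a b g h k r with family-lead-positive a b g h k r
  ... | l , lead≡ = length-toList (family +[1+ a ] b (+ g) h k r) , λ lead≡0 → +[1+l]≢0 (trans (sym lead≡) lead≡0)
    where
    +[1+l]≢0 : +[1+ l ] ≢ + 0
    +[1+l]≢0 ()

  -- (A − B, B) for the recurrences p_{r+1}(x) = A(x) p_r(x) − B(x) p_r(x − 1) of P, P̄, Q, Q̄.
  Pᵥ P̄ᵥ Qᵥ Q̄ᵥ : (r : ℕ) → Vec ℤ (suc r)
  Pᵥ = family (+ 1) (+ 0)   (+ 1) (- + 1) (+ 0)
  P̄ᵥ = family (+ 4) (- + 3) (+ 4) (- + 8) (+ 4)
  Qᵥ = family (+ 1) (+ 0)   (+ 2) (- + 1) (+ 0)
  Q̄ᵥ = family (+ 2) (+ 1)   (+ 4) (+ 2)   (+ 0)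

  Pᵥ-hasDegree : ∀ r → HasDegree (toList (Pᵥ r)) r
  Pᵥ-hasDegree = family-hasDegree 0 (+ 0) 1 (- + 1) (+ 0)

  P̄ᵥ-hasDegree : ∀ r → HasDegree (toList (P̄ᵥ r)) r
  P̄ᵥ-hasDegree = family-hasDegree 3 (- + 3) 4 (- + 8) (+ 4)

  Qᵥ-hasDegree : ∀ r → HasDegree (toList (Qᵥ r)) r
  Qᵥ-hasDegree = family-hasDegree 0 (+ 0) 2 (- + 1) (+ 0)

  Q̄ᵥ-hasDegree : ∀ r → HasDegree (toList (Q̄ᵥ r)) r
  Q̄ᵥ-hasDegree = family-hasDegree 1 (+ 1) 4 (+ 2) (+ 0)

  P-rec : ∀ r x → ⟦ Pᵥ (suc r) ⟧ x ≡ x * x * ⟦ Pᵥ r ⟧ x - x * (x - + 1) * ⟦ Pᵥ r ⟧ (x - + 1)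
  P-rec r x = trans (⟦step⟧ (+ 1) (+ 0) (+ 1) (- + 1) (+ 0) (Pᵥ r) x) (lemma x (⟦ Pᵥ r ⟧ x) (⟦ Pᵥ r ⟧ (x - + 1)))
    where
    lemma : ∀ x u v → (+ 1 * x + + 0) * u + (+ 1 * x * x + - + 1 * x + + 0) * (u - v) ≡ x * x * u - x * (x - + 1) * v
    lemma = solve-∀

  P̄-rec : ∀ r x → ⟦ P̄ᵥ (suc r) ⟧ x ≡
    (+ 2 * x - + 1) * (+ 2 * x - + 1) * ⟦ P̄ᵥ r ⟧ x - + 4 * ((x - + 1) * (x - + 1)) * ⟦ P̄ᵥ r ⟧ (x - + 1)
  P̄-rec r x =
    trans (⟦step⟧ (+ 4) (- + 3) (+ 4) (- + 8) (+ 4) (P̄ᵥ r) x) (lemma x (⟦ P̄ᵥ r ⟧ x) (⟦ P̄ᵥ r ⟧ (x - + 1)))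
    where
    lemma : ∀ x u v → (+ 4 * x + - + 3) * u + (+ 4 * x * x + - + 8 * x + + 4) * (u - v)
                    ≡ (+ 2 * x - + 1) * (+ 2 * x - + 1) * u - + 4 * ((x - + 1) * (x - + 1)) * v
    lemma = solve-∀

  Q-rec : ∀ r x → ⟦ Qᵥ (suc r) ⟧ x ≡ + 2 * (x * x) * ⟦ Qᵥ r ⟧ x - x * (+ 2 * x - + 1) * ⟦ Qᵥ r ⟧ (x - + 1)
  Q-rec r x = trans (⟦step⟧ (+ 1) (+ 0) (+ 2) (- + 1) (+ 0) (Qᵥ r) x) (lemma x (⟦ Qᵥ r ⟧ x) (⟦ Qᵥ r ⟧ (x - + 1)))
    where
    lemma : ∀ x u v → (+ 1 * x + + 0) * u + (+ 2 * x * x + - + 1 * x + + 0) * (u - v)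
                    ≡ + 2 * (x * x) * u - x * (+ 2 * x - + 1) * v
    lemma = solve-∀

  Q̄-rec : ∀ r x → ⟦ Q̄ᵥ (suc r) ⟧ x ≡
    (+ 2 * x + + 1) * (+ 2 * x + + 1) * ⟦ Q̄ᵥ r ⟧ x - + 2 * x * (+ 2 * x + + 1) * ⟦ Q̄ᵥ r ⟧ (x - + 1)
  Q̄-rec r x = trans (⟦step⟧ (+ 2) (+ 1) (+ 4) (+ 2) (+ 0) (Q̄ᵥ r) x) (lemma x (⟦ Q̄ᵥ r ⟧ x) (⟦ Q̄ᵥ r ⟧ (x - + 1)))
    where
    lemma : ∀ x u v → (+ 2 * x + + 1) * u + (+ 4 * x * x + + 2 * x + + 0) * (u - v)
                    ≡ (+ 2 * x + + 1) * (+ 2 * x + + 1) * u - + 2 * x * (+ 2 * x + + 1) * v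
    lemma = solve-∀

module ClosedForms where

  open import Data.Nat as ℕ using (ℕ; zero; suc)
  open import Data.Integer as ℤ using (ℤ; +_; _+_; _*_; _-_; _^_)
  open import Data.Integer.Properties as ℤ using (pos-*)
  import Data.Nat.Properties as ℕ
  open import Data.Integer.Tactic.RingSolver using (solve-∀)
  open import Relation.Binary.PropositionalEquality
  open ≡-Reasoning
  open Moments
  open Polynomials

  +[a+b]≡c⇒+a≡+c-+b : ∀ {a b c} → a ℕ.+ b ≡ c → + a ≡ + c - + b
  +[a+b]≡c⇒+a≡+c-+b {a} {b} refl = lemma (+ a) (+ b)
    where
    lemma : ∀ a b → a ≡ a + b - b
    lemma = solve-∀

  +double : ∀ n → + double n ≡ + 2 * + n
  +double n = trans (cong +_ (trans (double≡n+n n) (cong (n ℕ.+_) (sym (ℕ.+-identityʳ n))))) (pos-* 2 n)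

  +2^ : ∀ k → + (2 ℕ.^ k) ≡ (+ 2) ^ k
  +2^ zero    = refl
  +2^ (suc k) = trans (pos-* 2 (2 ℕ.^ k)) (cong (+ 2 *_) (+2^ k))

  -- N is any integer expression for 2 + n, so that callers can present it as 2x, 2x − 1 or 2x + 1.
  moment-recurrenceℤ : ∀ r n N → + (2 ℕ.+ n) ≡ N →
    + moment (2 ℕ.+ r) (2 ℕ.+ n) ≡ N * N * + moment r (2 ℕ.+ n) - + 4 * (N * (N - + 1)) * + moment r n
  moment-recurrenceℤ r n _ refl = begin
    + moment (2 ℕ.+ r) (2 ℕ.+ n)                                   ≡⟨ +[a+b]≡c⇒+a≡+c-+b (moment-recurrence r n) ⟩
    + ((2 ℕ.+ n) ℕ.* (2 ℕ.+ n) ℕ.* M₂) - + (4 ℕ.* ((2 ℕ.+ n) ℕ.* (1 ℕ.+ n)) ℕ.* M₀) ≡⟨ cong₂ _-_ square product ⟩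
    + (2 ℕ.+ n) * + (2 ℕ.+ n) * + M₂ - + 4 * (+ (2 ℕ.+ n) * + (1 ℕ.+ n)) * + M₀ ∎
    where
    M₂ = moment r (2 ℕ.+ n)
    M₀ = moment r n
    square : + ((2 ℕ.+ n) ℕ.* (2 ℕ.+ n) ℕ.* M₂) ≡ + (2 ℕ.+ n) * + (2 ℕ.+ n) * + M₂
    square = trans (pos-* ((2 ℕ.+ n) ℕ.* (2 ℕ.+ n)) M₂) (cong (_* + M₂) (pos-* (2 ℕ.+ n) (2 ℕ.+ n)))
    product : + (4 ℕ.* ((2 ℕ.+ n) ℕ.* (1 ℕ.+ n)) ℕ.* M₀) ≡ + 4 * (+ (2 ℕ.+ n) * + (1 ℕ.+ n)) * + M₀
    product = trans (pos-* (4 ℕ.* ((2 ℕ.+ n) ℕ.* (1 ℕ.+ n))) M₀)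
                    (cong (_* + M₀) (trans (pos-* 4 ((2 ℕ.+ n) ℕ.* (1 ℕ.+ n))) (cong (+ 4 *_) (pos-* (2 ℕ.+ n) (1 ℕ.+ n)))))

  moment-1 : ∀ r → moment r 1 ≡ 2
  moment-1 r rewrite ℕ.^-zeroˡ r = refl

  Q-at-0 : ∀ r → ⟦ Qᵥ (suc r) ⟧ (+ 0) ≡ + 0
  Q-at-0 r = trans (Q-rec r (+ 0)) (lemma (⟦ Qᵥ r ⟧ (+ 0)) (⟦ Qᵥ r ⟧ (+ 0 - + 1)))
    where
    lemma : ∀ u v → + 2 * (+ 0 * + 0) * u - + 0 * (+ 2 * + 0 - + 1) * v ≡ + 0
    lemma = solve-∀

  Q̄-at-0 : ∀ r → ⟦ Q̄ᵥ r ⟧ (+ 0) ≡ + 1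
  Q̄-at-0 zero    = refl
  Q̄-at-0 (suc r) = begin
    ⟦ Q̄ᵥ (suc r) ⟧ (+ 0)  ≡⟨ Q̄-rec r (+ 0) ⟩
    (+ 2 * + 0 + + 1) * (+ 2 * + 0 + + 1) * ⟦ Q̄ᵥ r ⟧ (+ 0) - + 2 * + 0 * (+ 2 * + 0 + + 1) * v
      ≡⟨ cong (λ u → (+ 2 * + 0 + + 1) * (+ 2 * + 0 + + 1) * u - + 2 * + 0 * (+ 2 * + 0 + + 1) * v) (Q̄-at-0 r) ⟩
    (+ 2 * + 0 + + 1) * (+ 2 * + 0 + + 1) * + 1 - + 2 * + 0 * (+ 2 * + 0 + + 1) * v ≡⟨ lemma v ⟩
    + 1 ∎
    where
    v = ⟦ Q̄ᵥ r ⟧ (+ 0 - + 1)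
    lemma : ∀ v → (+ 2 * + 0 + + 1) * (+ 2 * + 0 + + 1) * + 1 - + 2 * + 0 * (+ 2 * + 0 + + 1) * v ≡ + 1
    lemma = solve-∀

  P̄-at-1 : ∀ r → ⟦ P̄ᵥ r ⟧ (+ 1) ≡ + 1
  P̄-at-1 zero    = refl
  P̄-at-1 (suc r) = begin
    ⟦ P̄ᵥ (suc r) ⟧ (+ 1)  ≡⟨ P̄-rec r (+ 1) ⟩
    (+ 2 * + 1 - + 1) * (+ 2 * + 1 - + 1) * ⟦ P̄ᵥ r ⟧ (+ 1) - + 4 * ((+ 1 - + 1) * (+ 1 - + 1)) * v
      ≡⟨ cong (λ u → (+ 2 * + 1 - + 1) * (+ 2 * + 1 - + 1) * u - + 4 * ((+ 1 - + 1) * (+ 1 - + 1)) * v) (P̄-at-1 r) ⟩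
    (+ 2 * + 1 - + 1) * (+ 2 * + 1 - + 1) * + 1 - + 4 * ((+ 1 - + 1) * (+ 1 - + 1)) * v ≡⟨ lemma v ⟩
    + 1 ∎
    where
    v = ⟦ P̄ᵥ r ⟧ (+ 1 - + 1)
    lemma : ∀ v → (+ 2 * + 1 - + 1) * (+ 2 * + 1 - + 1) * + 1 - + 4 * ((+ 1 - + 1) * (+ 1 - + 1)) * v ≡ + 1
    lemma = solve-∀

  central-binom-sucℤ : ∀ m → let x = + suc m in
    x * + binom (double (suc m)) (suc m) ≡ + 2 * ((+ 2 * x - + 1) * + binom (double m) m)
  central-binom-sucℤ m = begin
    + suc m * + binom (double (suc m)) (suc m)           ≡⟨ pos-* (suc m) (binom (double (suc m)) (suc m)) ⟨
    + (suc m ℕ.* binom (double (suc m)) (suc m))         ≡⟨ cong +_ (central-binom-suc m) ⟩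
    + (2 ℕ.* (suc (double m) ℕ.* c))                     ≡⟨ pos-* 2 (suc (double m) ℕ.* c) ⟩
    + 2 * + (suc (double m) ℕ.* c)                       ≡⟨ cong (+ 2 *_) (pos-* (suc (double m)) c) ⟩
    + 2 * (+ suc (double m) * + c)                       ≡⟨ cong (λ y → + 2 * ((y - + 1) * + c)) (+double (suc m)) ⟩
    + 2 * ((+ 2 * + suc m - + 1) * + c)                  ∎
    where
    c = binom (double m) m

  moment-Q : ∀ r n → + moment (double r) (double n) ≡ (+ 2) ^ double n * (+ 2) ^ r * ⟦ Qᵥ r ⟧ (+ n)
  moment-Q zero    n       = begin
    + moment 0 (double n)                         ≡⟨ cong +_ (moment-0 (double n)) ⟩
    + (2 ℕ.^ double n)                            ≡⟨ +2^ (double n) ⟩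
    (+ 2) ^ double n                              ≡⟨ lemma ((+ 2) ^ double n) ⟩
    (+ 2) ^ double n * + 1 * + 1                  ≡⟨ cong ((+ 2) ^ double n * + 1 *_) (⟦constant⟧ (+ 1) (+ n)) ⟨
    (+ 2) ^ double n * + 1 * ⟦ Qᵥ 0 ⟧ (+ n)       ∎
    where
    lemma : ∀ t → t ≡ t * + 1 * + 1
    lemma = solve-∀
  moment-Q (suc r) zero    = begin
    + 0                                           ≡⟨ ℤ.*-zeroʳ (+ 1 * (+ 2) ^ suc r) ⟨
    + 1 * (+ 2) ^ suc r * + 0                     ≡⟨ cong (+ 1 * (+ 2) ^ suc r *_) (Q-at-0 r) ⟨
    + 1 * (+ 2) ^ suc r * ⟦ Qᵥ (suc r) ⟧ (+ 0)    ∎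
  -- By computation x − + 1 is + m and (+ 2) ^ double (suc m) is + 2 * (+ 2 * t), so the inductive
  -- hypotheses at suc m and m enter the chain unchanged; the same holds in the three proofs below.
  moment-Q (suc r) (suc m) = begin
    + moment (2 ℕ.+ double r) (2 ℕ.+ double m)
      ≡⟨ moment-recurrenceℤ (double r) (double m) N (+double (suc m)) ⟩
    N * N * + moment (double r) (double (suc m)) - + 4 * (N * (N - + 1)) * + moment (double r) (double m)
      ≡⟨ cong₂ (λ u v → N * N * u - + 4 * (N * (N - + 1)) * v) (moment-Q r (suc m)) (moment-Q r m) ⟩
    N * N * (+ 2 * (+ 2 * t) * s * q₁) - + 4 * (N * (N - + 1)) * (t * s * q₀)
      ≡⟨ lemma x t s q₁ q₀ ⟩
    + 2 * (+ 2 * t) * (+ 2 * s) * (+ 2 * (x * x) * q₁ - x * (+ 2 * x - + 1) * q₀)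
      ≡⟨ cong (+ 2 * (+ 2 * t) * (+ 2 * s) *_) (Q-rec r x) ⟨
    + 2 * (+ 2 * t) * (+ 2 * s) * ⟦ Qᵥ (suc r) ⟧ x ∎
    where
    x = + suc m
    N = + 2 * x
    t = (+ 2) ^ double m
    s = (+ 2) ^ r
    q₁ = ⟦ Qᵥ r ⟧ x
    q₀ = ⟦ Qᵥ r ⟧ (x - + 1)
    lemma : ∀ x t s q₁ q₀ → let N = + 2 * x in
      N * N * (+ 2 * (+ 2 * t) * s * q₁) - + 4 * (N * (N - + 1)) * (t * s * q₀)
      ≡ + 2 * (+ 2 * t) * (+ 2 * s) * (+ 2 * (x * x) * q₁ - x * (+ 2 * x - + 1) * q₀)
    lemma = solve-∀

  moment-Q̄ : ∀ r n → + moment (double r) (suc (double n)) ≡ (+ 2) ^ suc (double n) * ⟦ Q̄ᵥ r ⟧ (+ n)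
  moment-Q̄ zero    n       = begin
    + moment 0 (suc (double n))                   ≡⟨ cong +_ (moment-0 (suc (double n))) ⟩
    + (2 ℕ.^ suc (double n))                      ≡⟨ +2^ (suc (double n)) ⟩
    (+ 2) ^ suc (double n)                        ≡⟨ ℤ.*-identityʳ _ ⟨
    (+ 2) ^ suc (double n) * + 1                  ≡⟨ cong ((+ 2) ^ suc (double n) *_) (⟦constant⟧ (+ 1) (+ n)) ⟨
    (+ 2) ^ suc (double n) * ⟦ Q̄ᵥ 0 ⟧ (+ n)       ∎
  moment-Q̄ (suc r) zero    = begin
    + moment (double (suc r)) 1                   ≡⟨ cong +_ (moment-1 (double (suc r))) ⟩
    + 2 * + 1                                     ≡⟨ cong (λ q → + 2 * q) (Q̄-at-0 (suc r)) ⟨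
    + 2 * ⟦ Q̄ᵥ (suc r) ⟧ (+ 0)                    ∎
  moment-Q̄ (suc r) (suc m) = begin
    + moment (2 ℕ.+ double r) (2 ℕ.+ suc (double m))
      ≡⟨ moment-recurrenceℤ (double r) (suc (double m)) (+ 2 * x + + 1) (+double+1 (suc m)) ⟩
    N * N * + moment (double r) (suc (double (suc m))) - + 4 * (N * (N - + 1)) * + moment (double r) (suc (double m))
      ≡⟨ cong₂ (λ u v → N * N * u - + 4 * (N * (N - + 1)) * v) (moment-Q̄ r (suc m)) (moment-Q̄ r m) ⟩
    N * N * (+ 2 * (+ 2 * t) * q₁) - + 4 * (N * (N - + 1)) * (t * q₀)
      ≡⟨ lemma x t q₁ q₀ ⟩
    + 2 * (+ 2 * t) * ((+ 2 * x + + 1) * (+ 2 * x + + 1) * q₁ - + 2 * x * (+ 2 * x + + 1) * q₀)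
      ≡⟨ cong (+ 2 * (+ 2 * t) *_) (Q̄-rec r x) ⟨
    + 2 * (+ 2 * t) * ⟦ Q̄ᵥ (suc r) ⟧ x ∎
    where
    x = + suc m
    N = + 2 * x + + 1
    t = (+ 2) ^ suc (double m)
    q₁ = ⟦ Q̄ᵥ r ⟧ x
    q₀ = ⟦ Q̄ᵥ r ⟧ (x - + 1)
    +double+1 : ∀ n → + suc (double n) ≡ + 2 * + n + + 1
    +double+1 n = trans (cong (λ y → + 1 + y) (+double n)) (ℤ.+-comm (+ 1) (+ 2 * + n))
    lemma : ∀ x t q₁ q₀ → let N = + 2 * x + + 1 in
      N * N * (+ 2 * (+ 2 * t) * q₁) - + 4 * (N * (N - + 1)) * (t * q₀)
      ≡ + 2 * (+ 2 * t) * ((+ 2 * x + + 1) * (+ 2 * x + + 1) * q₁ - + 2 * x * (+ 2 * x + + 1) * q₀)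
    lemma = solve-∀

  moment-P : ∀ r n → + moment (suc (double r)) (double n) ≡ (+ 2) ^ suc (double r) * (+ n * (⟦ Pᵥ r ⟧ (+ n) * + binom (double n) n))
  moment-P zero    n       = begin
    + moment 1 (double n)                 ≡⟨ cong +_ (moment-1-even n) ⟩
    + (double n ℕ.* c)                    ≡⟨ pos-* (double n) c ⟩
    + double n * + c                      ≡⟨ cong (_* + c) (+double n) ⟩
    + 2 * + n * + c                       ≡⟨ lemma (+ n) (+ c) ⟩
    + 2 * + 1 * (+ n * (+ 1 * + c))       ≡⟨ cong (λ p → + 2 * + 1 * (+ n * (p * + c))) (⟦constant⟧ (+ 1) (+ n)) ⟨
    + 2 * + 1 * (+ n * (⟦ Pᵥ 0 ⟧ (+ n) * + c)) ∎
    where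
    c = binom (double n) n
    lemma : ∀ n c → + 2 * n * c ≡ + 2 * + 1 * (n * (+ 1 * c))
    lemma = solve-∀
  moment-P (suc r) zero    = sym (ℤ.*-zeroʳ ((+ 2) ^ suc (double (suc r))))
  moment-P (suc r) (suc m) = begin
    + moment (2 ℕ.+ suc (double r)) (2 ℕ.+ double m)
      ≡⟨ moment-recurrenceℤ (suc (double r)) (double m) N (+double (suc m)) ⟩
    N * N * + moment (suc (double r)) (double (suc m)) - + 4 * (N * (N - + 1)) * + moment (suc (double r)) (double m)
      ≡⟨ cong₂ (λ u v → N * N * u - + 4 * (N * (N - + 1)) * v) (moment-P r (suc m)) (moment-P r m) ⟩
    N * N * (t * (x * (p₁ * c₁))) - + 4 * (N * (N - + 1)) * (t * ((x - + 1) * (p₀ * c₀)))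
      ≡⟨ lemma x t p₁ p₀ c₁ c₀ ⟩
    N * N * (t * (x * (p₁ * c₁))) - + 4 * t * (x - + 1) * p₀ * x * (+ 2 * ((+ 2 * x - + 1) * c₀))
      ≡⟨ cong (λ y → N * N * (t * (x * (p₁ * c₁))) - + 4 * t * (x - + 1) * p₀ * x * y) (central-binom-sucℤ m) ⟨
    N * N * (t * (x * (p₁ * c₁))) - + 4 * t * (x - + 1) * p₀ * x * (x * c₁)
      ≡⟨ lemma′ x t p₁ p₀ c₁ ⟩
    + 2 * (+ 2 * t) * (x * ((x * x * p₁ - x * (x - + 1) * p₀) * c₁))
      ≡⟨ cong (λ p → + 2 * (+ 2 * t) * (x * (p * c₁))) (P-rec r x) ⟨
    + 2 * (+ 2 * t) * (x * (⟦ Pᵥ (suc r) ⟧ x * c₁)) ∎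
    where
    x = + suc m
    N = + 2 * x
    t = (+ 2) ^ suc (double r)
    p₁ = ⟦ Pᵥ r ⟧ x
    p₀ = ⟦ Pᵥ r ⟧ (x - + 1)
    c₁ = + binom (double (suc m)) (suc m)
    c₀ = + binom (double m) m
    lemma : ∀ x t p₁ p₀ c₁ c₀ → let N = + 2 * x in
      N * N * (t * (x * (p₁ * c₁))) - + 4 * (N * (N - + 1)) * (t * ((x - + 1) * (p₀ * c₀)))
      ≡ N * N * (t * (x * (p₁ * c₁))) - + 4 * t * (x - + 1) * p₀ * x * (+ 2 * ((+ 2 * x - + 1) * c₀))
    lemma = solve-∀
    lemma′ : ∀ x t p₁ p₀ c₁ → let N = + 2 * x in
      N * N * (t * (x * (p₁ * c₁))) - + 4 * t * (x - + 1) * p₀ * x * (x * c₁)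
      ≡ + 2 * (+ 2 * t) * (x * ((x * x * p₁ - x * (x - + 1) * p₀) * c₁))
    lemma′ = solve-∀

  moment-P̄ : ∀ r m → + moment (suc (double r)) (suc (double m)) ≡ + suc m * (⟦ P̄ᵥ r ⟧ (+ suc m) * + binom (double (suc m)) (suc m))
  moment-P̄ zero    m       = begin
    + moment 1 (suc (double m))          ≡⟨ cong +_ (moment-1-odd m) ⟩
    + (suc m ℕ.* c)                      ≡⟨ pos-* (suc m) c ⟩
    + suc m * + c                        ≡⟨ cong (λ y → + suc m * y) (ℤ.*-identityˡ (+ c)) ⟨
    + suc m * (+ 1 * + c)                ≡⟨ cong (λ p → + suc m * (p * + c)) (⟦constant⟧ (+ 1) (+ suc m)) ⟨
    + suc m * (⟦ P̄ᵥ 0 ⟧ (+ suc m) * + c) ∎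
    where
    c = binom (double (suc m)) (suc m)
  moment-P̄ (suc r) zero    = begin
    + moment (suc (double (suc r))) 1    ≡⟨ cong +_ (moment-1 (suc (double (suc r)))) ⟩
    + 1 * (+ 1 * + 2)                    ≡⟨ cong (λ p → + 1 * (p * + 2)) (P̄-at-1 (suc r)) ⟨
    + 1 * (⟦ P̄ᵥ (suc r) ⟧ (+ 1) * + 2)   ∎
  moment-P̄ (suc r) (suc m) = begin
    + moment (2 ℕ.+ suc (double r)) (2 ℕ.+ suc (double m))
      ≡⟨ moment-recurrenceℤ (suc (double r)) (suc (double m)) N (cong (_- + 1) (+double (suc (suc m)))) ⟩
    N * N * + moment (suc (double r)) (suc (double (suc m))) - + 4 * (N * (N - + 1)) * + moment (suc (double r)) (suc (double m))
      ≡⟨ cong₂ (λ u v → N * N * u - + 4 * (N * (N - + 1)) * v) (moment-P̄ r (suc m)) (moment-P̄ r m) ⟩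
    N * N * (x * (p₁ * c₁)) - + 4 * (N * (N - + 1)) * ((x - + 1) * (p₀ * c₀))
      ≡⟨ lemma x p₁ p₀ c₁ c₀ ⟩
    N * N * (x * (p₁ * c₁)) - + 4 * ((x - + 1) * (x - + 1)) * p₀ * (+ 2 * ((+ 2 * x - + 1) * c₀))
      ≡⟨ cong (λ y → N * N * (x * (p₁ * c₁)) - + 4 * ((x - + 1) * (x - + 1)) * p₀ * y) (central-binom-sucℤ (suc m)) ⟨
    N * N * (x * (p₁ * c₁)) - + 4 * ((x - + 1) * (x - + 1)) * p₀ * (x * c₁)
      ≡⟨ lemma′ x p₁ p₀ c₁ ⟩
    x * ((N * N * p₁ - + 4 * ((x - + 1) * (x - + 1)) * p₀) * c₁)
      ≡⟨ cong (λ p → x * (p * c₁)) (P̄-rec r x) ⟨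
    x * (⟦ P̄ᵥ (suc r) ⟧ x * c₁) ∎
    where
    x = + suc (suc m)
    N = + 2 * x - + 1
    p₁ = ⟦ P̄ᵥ r ⟧ x
    p₀ = ⟦ P̄ᵥ r ⟧ (x - + 1)
    c₁ = + binom (double (suc (suc m))) (suc (suc m))
    c₀ = + binom (double (suc m)) (suc m)
    lemma : ∀ x p₁ p₀ c₁ c₀ → let N = + 2 * x - + 1 in
      N * N * (x * (p₁ * c₁)) - + 4 * (N * (N - + 1)) * ((x - + 1) * (p₀ * c₀))
      ≡ N * N * (x * (p₁ * c₁)) - + 4 * ((x - + 1) * (x - + 1)) * p₀ * (+ 2 * ((+ 2 * x - + 1) * c₀))
    lemma = solve-∀
    lemma′ : ∀ x p₁ p₀ c₁ → let N = + 2 * x - + 1 in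
      N * N * (x * (p₁ * c₁)) - + 4 * ((x - + 1) * (x - + 1)) * p₀ * (x * c₁)
      ≡ x * ((N * N * p₁ - + 4 * ((x - + 1) * (x - + 1)) * p₀) * c₁)
    lemma′ = solve-∀

module RationalMoments where

  open import Data.Nat as ℕ using (ℕ; zero; suc; NonZero)
  import Data.Nat.Properties as ℕ
  open import Data.Nat.Combinatorics using (_C_)
  open import Data.Integer as ℤ using (ℤ; +_)
  import Data.Integer.Properties as ℤ
  open import Data.Integer.Tactic.RingSolver using (solve-∀)
  open import Data.Rational as ℚ using (ℚ; 1ℚ; ½; ∣_∣; _+_; _*_; _-_; -_)
  import Data.Rational.Properties as ℚ
  import Data.Rational.Unnormalised as ℚᵘ
  import Data.Rational.Unnormalised.Properties as ℚᵘ
  open import Data.Rational.Solver using (module +-*-Solver)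
  open +-*-Solver using (solve; _:+_; _:*_; _:-_; :-_; _:=_; con)
  open import Data.List using (map; applyUpTo)
  open import Data.Sum using (inj₁; inj₂)
  open import Relation.Binary.PropositionalEquality
  open import Defs
  open Moments using (∑<; double; double≡n+n; binom; binom≡C; momentTerm; moment)
  open Polynomials using (⟦_⟧; Pᵥ; P̄ᵥ; Qᵥ; Q̄ᵥ)
  open ClosedForms using (moment-P; moment-P̄; moment-Q; moment-Q̄)


  ℤ→ℚ-+ : ∀ a b → ℤ→ℚ (a ℤ.+ b) ≡ ℤ→ℚ a + ℤ→ℚ b
  ℤ→ℚ-+ a b = ℚ.toℚᵘ-injective (begin
    ℚ.toℚᵘ (ℤ→ℚ (a ℤ.+ b))                       ≈⟨ ℚ.toℚᵘ-fromℚᵘ (ℚᵘ.mkℚᵘ (a ℤ.+ b) 0) ⟩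
    ℚᵘ.mkℚᵘ (a ℤ.+ b) 0                           ≈⟨ ℚᵘ.*≡* (lemma a b) ⟩
    ℚᵘ.mkℚᵘ a 0 ℚᵘ.+ ℚᵘ.mkℚᵘ b 0                  ≈⟨ ℚᵘ.+-cong (ℚ.toℚᵘ-fromℚᵘ (ℚᵘ.mkℚᵘ a 0)) (ℚ.toℚᵘ-fromℚᵘ (ℚᵘ.mkℚᵘ b 0)) ⟨
    ℚ.toℚᵘ (ℤ→ℚ a) ℚᵘ.+ ℚ.toℚᵘ (ℤ→ℚ b)           ≈⟨ ℚ.toℚᵘ-homo-+ (ℤ→ℚ a) (ℤ→ℚ b) ⟨
    ℚ.toℚᵘ (ℤ→ℚ a + ℤ→ℚ b)                        ∎)
    where
    open ℚᵘ.≃-Reasoning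
    lemma : ∀ a b → (a ℤ.+ b) ℤ.* + 1 ≡ (a ℤ.* + 1 ℤ.+ b ℤ.* + 1) ℤ.* + 1
    lemma = solve-∀

  ℤ→ℚ-* : ∀ a b → ℤ→ℚ (a ℤ.* b) ≡ ℤ→ℚ a * ℤ→ℚ b
  ℤ→ℚ-* a b = ℚ.toℚᵘ-injective (begin
    ℚ.toℚᵘ (ℤ→ℚ (a ℤ.* b))                       ≈⟨ ℚ.toℚᵘ-fromℚᵘ (ℚᵘ.mkℚᵘ (a ℤ.* b) 0) ⟩
    ℚᵘ.mkℚᵘ (a ℤ.* b) 0                           ≈⟨ ℚᵘ.*≡* refl ⟩
    ℚᵘ.mkℚᵘ a 0 ℚᵘ.* ℚᵘ.mkℚᵘ b 0                  ≈⟨ ℚᵘ.*-cong (ℚ.toℚᵘ-fromℚᵘ (ℚᵘ.mkℚᵘ a 0)) (ℚ.toℚᵘ-fromℚᵘ (ℚᵘ.mkℚᵘ b 0)) ⟨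
    ℚ.toℚᵘ (ℤ→ℚ a) ℚᵘ.* ℚ.toℚᵘ (ℤ→ℚ b)           ≈⟨ ℚ.toℚᵘ-homo-* (ℤ→ℚ a) (ℤ→ℚ b) ⟨
    ℚ.toℚᵘ (ℤ→ℚ a * ℤ→ℚ b)                        ∎)
    where open ℚᵘ.≃-Reasoning

  ℕ→ℚ-+ : ∀ m n → ℕ→ℚ (m ℕ.+ n) ≡ ℕ→ℚ m + ℕ→ℚ n
  ℕ→ℚ-+ m n = ℤ→ℚ-+ (+ m) (+ n)

  ℕ→ℚ-* : ∀ m n → ℕ→ℚ (m ℕ.* n) ≡ ℕ→ℚ m * ℕ→ℚ n
  ℕ→ℚ-* m n = trans (cong ℤ→ℚ (ℤ.pos-* m n)) (ℤ→ℚ-* (+ m) (+ n))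

  ^ℚ-distribʳ-* : ∀ x y r → (x * y) ^ℚ r ≡ x ^ℚ r * y ^ℚ r
  ^ℚ-distribʳ-* x y zero    = refl
  ^ℚ-distribʳ-* x y (suc r) = trans (cong ((x * y) *_) (^ℚ-distribʳ-* x y r))
    (solve 4 (λ x y u v → (x :* y) :* (u :* v) := (x :* u) :* (y :* v)) refl x y (x ^ℚ r) (y ^ℚ r))

  ^ℚ-distribˡ-+ : ∀ x m n → x ^ℚ (m ℕ.+ n) ≡ x ^ℚ m * x ^ℚ n
  ^ℚ-distribˡ-+ x zero    n = sym (ℚ.*-identityˡ (x ^ℚ n))
  ^ℚ-distribˡ-+ x (suc m) n = trans (cong (x *_) (^ℚ-distribˡ-+ x m n)) (sym (ℚ.*-assoc x (x ^ℚ m) (x ^ℚ n)))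

  1^ℚr≡1 : ∀ r → 1ℚ ^ℚ r ≡ 1ℚ
  1^ℚr≡1 zero    = refl
  1^ℚr≡1 (suc r) = trans (ℚ.*-identityˡ (1ℚ ^ℚ r)) (1^ℚr≡1 r)

  2^r*½^r≡1 : ∀ r → ℕ→ℚ 2 ^ℚ r * ½ ^ℚ r ≡ 1ℚ
  2^r*½^r≡1 r = trans (sym (^ℚ-distribʳ-* (ℕ→ℚ 2) ½ r)) (1^ℚr≡1 r)

  ℕ→ℚ-^ : ∀ m r → ℕ→ℚ (m ℕ.^ r) ≡ ℕ→ℚ m ^ℚ r
  ℕ→ℚ-^ m zero    = refl
  ℕ→ℚ-^ m (suc r) = trans (ℕ→ℚ-* m (m ℕ.^ r)) (cong (ℕ→ℚ m *_) (ℕ→ℚ-^ m r))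

  ℤ→ℚ-2^ : ∀ r → ℤ→ℚ ((+ 2) ℤ.^ r) ≡ ℕ→ℚ 2 ^ℚ r
  ℤ→ℚ-2^ zero    = refl
  ℤ→ℚ-2^ (suc r) = trans (ℤ→ℚ-* (+ 2) ((+ 2) ℤ.^ r)) (cong (ℕ→ℚ 2 *_) (ℤ→ℚ-2^ r))

  ∣n*½∣≡n*½ : ∀ n → ∣ ℕ→ℚ n * ½ ∣ ≡ ℕ→ℚ n * ½
  ∣n*½∣≡n*½ n = trans (ℚ.∣p*q∣≡∣p∣*∣q∣ (ℕ→ℚ n) ½)
    (cong (_* ½) (ℚ.0≤p⇒∣p∣≡p (ℚ.nonNegative⁻¹ (ℕ→ℚ n) {{ℚ.normalize-nonNeg n 1}})))

  ∣n*½-k∣≡∣n-2k∣*½ : ∀ n k → ∣ ℕ→ℚ n * ½ - ℕ→ℚ k ∣ ≡ ℕ→ℚ ℕ.∣ n - double k ∣ * ½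
  ∣n*½-k∣≡∣n-2k∣*½ n k with ℕ.≤-total (double k) n
  ... | inj₁ 2k≤n = begin
    ∣ ℕ→ℚ n * ½ - ℕ→ℚ k ∣                     ≡⟨ cong (λ m → ∣ ℕ→ℚ m * ½ - ℕ→ℚ k ∣) n≡k+k+t ⟩
    ∣ ℕ→ℚ (k ℕ.+ k ℕ.+ t) * ½ - ℕ→ℚ k ∣
      ≡⟨ cong (λ q → ∣ q * ½ - ℕ→ℚ k ∣) (trans (ℕ→ℚ-+ (k ℕ.+ k) t) (cong (_+ ℕ→ℚ t) (ℕ→ℚ-+ k k))) ⟩
    ∣ (ℕ→ℚ k + ℕ→ℚ k + ℕ→ℚ t) * ½ - ℕ→ℚ k ∣
      ≡⟨ cong ∣_∣ (solve 2 (λ k t → (k :+ k :+ t) :* con ½ :- k := t :* con ½) refl (ℕ→ℚ k) (ℕ→ℚ t)) ⟩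
    ∣ ℕ→ℚ t * ½ ∣                             ≡⟨ ∣n*½∣≡n*½ t ⟩
    ℕ→ℚ t * ½                                 ≡⟨ cong (λ m → ℕ→ℚ m * ½) (ℕ.m≤n⇒∣n-m∣≡n∸m 2k≤n) ⟨
    ℕ→ℚ ℕ.∣ n - double k ∣ * ½                 ∎
    where
    open ≡-Reasoning
    t = n ℕ.∸ double k
    n≡k+k+t : n ≡ k ℕ.+ k ℕ.+ t
    n≡k+k+t = trans (sym (ℕ.m+[n∸m]≡n 2k≤n)) (cong (ℕ._+ t) (double≡n+n k))
  ... | inj₂ n≤2k = begin
    ∣ ℕ→ℚ n * ½ - ℕ→ℚ k ∣
      ≡⟨ cong ∣_∣ (solve 2 (λ n k → n :* con ½ :- k := n :* con ½ :- (k :+ k) :* con ½) refl (ℕ→ℚ n) (ℕ→ℚ k)) ⟩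
    ∣ ℕ→ℚ n * ½ - (ℕ→ℚ k + ℕ→ℚ k) * ½ ∣
      ≡⟨ cong (λ q → ∣ ℕ→ℚ n * ½ - q * ½ ∣) (trans (sym (ℕ→ℚ-+ k k)) (cong ℕ→ℚ k+k≡n+t)) ⟩
    ∣ ℕ→ℚ n * ½ - ℕ→ℚ (n ℕ.+ t) * ½ ∣         ≡⟨ cong (λ q → ∣ ℕ→ℚ n * ½ - q * ½ ∣) (ℕ→ℚ-+ n t) ⟩
    ∣ ℕ→ℚ n * ½ - (ℕ→ℚ n + ℕ→ℚ t) * ½ ∣
      ≡⟨ cong ∣_∣ (solve 2 (λ n t → n :* con ½ :- (n :+ t) :* con ½ := :- (t :* con ½)) refl (ℕ→ℚ n) (ℕ→ℚ t)) ⟩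
    ∣ - (ℕ→ℚ t * ½) ∣                         ≡⟨ ℚ.∣-p∣≡∣p∣ (ℕ→ℚ t * ½) ⟩
    ∣ ℕ→ℚ t * ½ ∣                             ≡⟨ ∣n*½∣≡n*½ t ⟩
    ℕ→ℚ t * ½                                 ≡⟨ cong (λ m → ℕ→ℚ m * ½) (ℕ.m≤n⇒∣m-n∣≡n∸m n≤2k) ⟨
    ℕ→ℚ ℕ.∣ n - double k ∣ * ½                 ∎
    where
    open ≡-Reasoning
    t = double k ℕ.∸ n
    k+k≡n+t : k ℕ.+ k ≡ n ℕ.+ t
    k+k≡n+t = trans (sym (double≡n+n k)) (sym (ℕ.m+[n∸m]≡n n≤2k))

  sumℚ-applyUpTo : ∀ m (F : ℕ → ℚ) (g f : ℕ → ℕ) c → (∀ k → F (g k) ≡ ℕ→ℚ (f k) * c) →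
    sumℚ (map F (applyUpTo g m)) ≡ ℕ→ℚ (∑< m f) * c
  sumℚ-applyUpTo zero    F g f c Fg≡fc = sym (ℚ.*-zeroˡ c)
  sumℚ-applyUpTo (suc m) F g f c Fg≡fc = begin
    F (g 0) + sumℚ (map F (applyUpTo (λ k → g (suc k)) m))
      ≡⟨ cong₂ _+_ (Fg≡fc 0) (sumℚ-applyUpTo m F (λ k → g (suc k)) (λ k → f (suc k)) c (λ k → Fg≡fc (suc k))) ⟩
    ℕ→ℚ (f 0) * c + ℕ→ℚ (∑< m (λ k → f (suc k))) * c ≡⟨ ℚ.*-distribʳ-+ c (ℕ→ℚ (f 0)) _ ⟨
    (ℕ→ℚ (f 0) + ℕ→ℚ (∑< m (λ k → f (suc k)))) * c   ≡⟨ cong (_* c) (ℕ→ℚ-+ (f 0) _) ⟨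
    ℕ→ℚ (∑< (suc m) f) * c                            ∎
    where open ≡-Reasoning

  U≡moment*½^r : ∀ r n → U r n ≡ ℕ→ℚ (moment r n) * ½ ^ℚ r
  U≡moment*½^r r n = sumℚ-applyUpTo (suc n) _ (λ k → k) (momentTerm r n) (½ ^ℚ r) term
    where
    open ≡-Reasoning
    term : ∀ k → ℕ→ℚ (n C k) * (∣ ℕ→ℚ n * ½ - ℕ→ℚ k ∣ ^ℚ r) ≡ ℕ→ℚ (momentTerm r n k) * ½ ^ℚ r
    term k = begin
      ℕ→ℚ (n C k) * (∣ ℕ→ℚ n * ½ - ℕ→ℚ k ∣ ^ℚ r)
        ≡⟨ cong₂ (λ b q → ℕ→ℚ b * q ^ℚ r) (sym (binom≡C n k)) (∣n*½-k∣≡∣n-2k∣*½ n k) ⟩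
      ℕ→ℚ (binom n k) * ((ℕ→ℚ d * ½) ^ℚ r)        ≡⟨ cong (ℕ→ℚ (binom n k) *_) (^ℚ-distribʳ-* (ℕ→ℚ d) ½ r) ⟩
      ℕ→ℚ (binom n k) * (ℕ→ℚ d ^ℚ r * ½ ^ℚ r)     ≡⟨ ℚ.*-assoc (ℕ→ℚ (binom n k)) _ _ ⟨
      ℕ→ℚ (binom n k) * ℕ→ℚ d ^ℚ r * ½ ^ℚ r       ≡⟨ cong (λ q → ℕ→ℚ (binom n k) * q * ½ ^ℚ r) (ℕ→ℚ-^ d r) ⟨
      ℕ→ℚ (binom n k) * ℕ→ℚ (d ℕ.^ r) * ½ ^ℚ r    ≡⟨ cong (_* ½ ^ℚ r) (ℕ→ℚ-* (binom n k) (d ℕ.^ r)) ⟨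
      ℕ→ℚ (momentTerm r n k) * ½ ^ℚ r             ∎
      where
      d = ℕ.∣ n - double k ∣

  2*n≡double : ∀ n → 2 ℕ.* n ≡ double n
  2*n≡double n = trans (cong (n ℕ.+_) (ℕ.+-identityʳ n)) (sym (double≡n+n n))

  2*n+1≡1+double : ∀ n → 2 ℕ.* n ℕ.+ 1 ≡ suc (double n)
  2*n+1≡1+double n = trans (ℕ.+-comm (2 ℕ.* n) 1) (cong suc (2*n≡double n))

  binom-central≡C : ∀ n → binom (double n) n ≡ (2 ℕ.* n) C n
  binom-central≡C n = trans (binom≡C (double n) n) (cong (_C n) (sym (2*n≡double n)))

  2^k*q*½^k≡q : ∀ k q → ℤ→ℚ ((+ 2) ℤ.^ k) * q * ½ ^ℚ k ≡ q
  2^k*q*½^k≡q k q = begin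
    ℤ→ℚ ((+ 2) ℤ.^ k) * q * ½ ^ℚ k    ≡⟨ cong (λ t → t * q * ½ ^ℚ k) (ℤ→ℚ-2^ k) ⟩
    ℕ→ℚ 2 ^ℚ k * q * ½ ^ℚ k           ≡⟨ solve 3 (λ t q h → t :* q :* h := q :* (t :* h)) refl (ℕ→ℚ 2 ^ℚ k) q (½ ^ℚ k) ⟩
    q * (ℕ→ℚ 2 ^ℚ k * ½ ^ℚ k)         ≡⟨ cong (q *_) (2^r*½^r≡1 k) ⟩
    q * 1ℚ                            ≡⟨ ℚ.*-identityʳ q ⟩
    q                                 ∎
    where open ≡-Reasoning

  ℤ→ℚ-*₃ : ∀ a b c → ℤ→ℚ (a ℤ.* (b ℤ.* c)) ≡ ℤ→ℚ a * ℤ→ℚ b * ℤ→ℚ c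
  ℤ→ℚ-*₃ a b c =
    trans (trans (ℤ→ℚ-* a (b ℤ.* c)) (cong (ℤ→ℚ a *_) (ℤ→ℚ-* b c))) (sym (ℚ.*-assoc (ℤ→ℚ a) _ _))

  U-P : ∀ r n → U (2 ℕ.* r ℕ.+ 1) (2 ℕ.* n) ≡ ℕ→ℚ n * ℤ→ℚ (⟦ Pᵥ r ⟧ (+ n)) * ℕ→ℚ ((2 ℕ.* n) C n)
  U-P r n = begin
    U (2 ℕ.* r ℕ.+ 1) (2 ℕ.* n)                          ≡⟨ U≡moment*½^r (2 ℕ.* r ℕ.+ 1) (2 ℕ.* n) ⟩
    ℕ→ℚ (moment (2 ℕ.* r ℕ.+ 1) (2 ℕ.* n)) * ½ ^ℚ (2 ℕ.* r ℕ.+ 1)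
      ≡⟨ cong₂ (λ s m → ℕ→ℚ (moment s m) * ½ ^ℚ s) (2*n+1≡1+double r) (2*n≡double n) ⟩
    ℤ→ℚ (+ moment (suc (double r)) (double n)) * h       ≡⟨ cong (λ z → ℤ→ℚ z * h) (moment-P r n) ⟩
    ℤ→ℚ ((+ 2) ℤ.^ suc (double r) ℤ.* x) * h            ≡⟨ cong (_* h) (ℤ→ℚ-* ((+ 2) ℤ.^ suc (double r)) x) ⟩
    ℤ→ℚ ((+ 2) ℤ.^ suc (double r)) * ℤ→ℚ x * h          ≡⟨ 2^k*q*½^k≡q (suc (double r)) (ℤ→ℚ x) ⟩
    ℤ→ℚ (+ n ℤ.* (p ℤ.* + c))                           ≡⟨ ℤ→ℚ-*₃ (+ n) p (+ c) ⟩
    ℕ→ℚ n * ℤ→ℚ p * ℕ→ℚ c                               ≡⟨ cong (λ b → ℕ→ℚ n * ℤ→ℚ p * ℕ→ℚ b) (binom-central≡C n) ⟩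
    ℕ→ℚ n * ℤ→ℚ p * ℕ→ℚ ((2 ℕ.* n) C n)                 ∎
    where
    open ≡-Reasoning
    h = ½ ^ℚ suc (double r)
    p = ⟦ Pᵥ r ⟧ (+ n)
    c = binom (double n) n
    x = + n ℤ.* (p ℤ.* + c)

  U-P̄ : ∀ r n → .{{NonZero n}} →
    U (2 ℕ.* r ℕ.+ 1) (2 ℕ.* n ℕ.∸ 1) ≡ (½ ^ℚ (2 ℕ.* r ℕ.+ 1)) * ℕ→ℚ n * ℤ→ℚ (⟦ P̄ᵥ r ⟧ (+ n)) * ℕ→ℚ ((2 ℕ.* n) C n)
  U-P̄ r (suc m) = begin
    U (2 ℕ.* r ℕ.+ 1) (2 ℕ.* suc m ℕ.∸ 1)                ≡⟨ U≡moment*½^r (2 ℕ.* r ℕ.+ 1) (2 ℕ.* suc m ℕ.∸ 1) ⟩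
    ℕ→ℚ (moment (2 ℕ.* r ℕ.+ 1) (2 ℕ.* suc m ℕ.∸ 1)) * h
      ≡⟨ cong₂ (λ s m → ℕ→ℚ (moment s m) * h) (2*n+1≡1+double r) (cong (ℕ._∸ 1) (2*n≡double (suc m))) ⟩
    ℤ→ℚ (+ moment (suc (double r)) (suc (double m))) * h ≡⟨ cong (λ z → ℤ→ℚ z * h) (moment-P̄ r m) ⟩
    ℤ→ℚ (+ suc m ℤ.* (p ℤ.* + c)) * h                   ≡⟨ cong (_* h) (ℤ→ℚ-*₃ (+ suc m) p (+ c)) ⟩
    ℕ→ℚ (suc m) * ℤ→ℚ p * ℕ→ℚ c * h
      ≡⟨ solve 4 (λ n p c h → n :* p :* c :* h := h :* n :* p :* c) refl (ℕ→ℚ (suc m)) (ℤ→ℚ p) (ℕ→ℚ c) h ⟩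
    h * ℕ→ℚ (suc m) * ℤ→ℚ p * ℕ→ℚ c
      ≡⟨ cong (λ b → h * ℕ→ℚ (suc m) * ℤ→ℚ p * ℕ→ℚ b) (binom-central≡C (suc m)) ⟩
    h * ℕ→ℚ (suc m) * ℤ→ℚ p * ℕ→ℚ ((2 ℕ.* suc m) C suc m) ∎
    where
    open ≡-Reasoning
    h = ½ ^ℚ (2 ℕ.* r ℕ.+ 1)
    p = ⟦ P̄ᵥ r ⟧ (+ suc m)
    c = binom (double (suc m)) (suc m)

  U-Q : ∀ r n → U (2 ℕ.* r) (2 ℕ.* n) ≡ (ℕ→ℚ 2 ^ℚ (2 ℕ.* n)) * (½ ^ℚ r) * ℤ→ℚ (⟦ Qᵥ r ⟧ (+ n))
  U-Q r n = begin
    U (2 ℕ.* r) (2 ℕ.* n)                                ≡⟨ U≡moment*½^r (2 ℕ.* r) (2 ℕ.* n) ⟩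
    ℕ→ℚ (moment (2 ℕ.* r) (2 ℕ.* n)) * ½ ^ℚ (2 ℕ.* r)
      ≡⟨ cong₂ (λ s m → ℕ→ℚ (moment s m) * ½ ^ℚ s) (2*n≡double r) (2*n≡double n) ⟩
    ℤ→ℚ (+ moment (double r) (double n)) * ½ ^ℚ double r ≡⟨ cong₂ (λ z e → ℤ→ℚ z * ½ ^ℚ e) (moment-Q r n) (double≡n+n r) ⟩
    ℤ→ℚ (t ℤ.* s ℤ.* q) * ½ ^ℚ (r ℕ.+ r)               ≡⟨ cong₂ _*_ (trans (ℤ→ℚ-* (t ℤ.* s) q) (cong (_* ℤ→ℚ q) (ℤ→ℚ-* t s)))
                                                                      (^ℚ-distribˡ-+ ½ r r) ⟩
    ℤ→ℚ t * ℤ→ℚ s * ℤ→ℚ q * (h * h)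
      ≡⟨ solve 4 (λ t s q h → t :* s :* q :* (h :* h) := t :* h :* q :* (s :* h)) refl (ℤ→ℚ t) (ℤ→ℚ s) (ℤ→ℚ q) h ⟩
    ℤ→ℚ t * h * ℤ→ℚ q * (ℤ→ℚ s * h)
      ≡⟨ cong₂ (λ u v → u * h * ℤ→ℚ q * v) (ℤ→ℚ-2^ (double n)) (trans (cong (_* h) (ℤ→ℚ-2^ r)) (2^r*½^r≡1 r)) ⟩
    ℕ→ℚ 2 ^ℚ double n * h * ℤ→ℚ q * 1ℚ                 ≡⟨ ℚ.*-identityʳ _ ⟩
    ℕ→ℚ 2 ^ℚ double n * h * ℤ→ℚ q                      ≡⟨ cong (λ e → ℕ→ℚ 2 ^ℚ e * h * ℤ→ℚ q) (2*n≡double n) ⟨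
    ℕ→ℚ 2 ^ℚ (2 ℕ.* n) * h * ℤ→ℚ q                     ∎
    where
    open ≡-Reasoning
    h = ½ ^ℚ r
    t = (+ 2) ℤ.^ double n
    s = (+ 2) ℤ.^ r
    q = ⟦ Qᵥ r ⟧ (+ n)

  U-Q̄ : ∀ r n → U (2 ℕ.* r) (2 ℕ.* n ℕ.+ 1) ≡ (ℕ→ℚ 2 ^ℚ (2 ℕ.* n ℕ.+ 1)) * (½ ^ℚ (2 ℕ.* r)) * ℤ→ℚ (⟦ Q̄ᵥ r ⟧ (+ n))
  U-Q̄ r n = begin
    U (2 ℕ.* r) (2 ℕ.* n ℕ.+ 1)                          ≡⟨ U≡moment*½^r (2 ℕ.* r) (2 ℕ.* n ℕ.+ 1) ⟩
    ℕ→ℚ (moment (2 ℕ.* r) (2 ℕ.* n ℕ.+ 1)) * h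
      ≡⟨ cong₂ (λ s m → ℕ→ℚ (moment s m) * h) (2*n≡double r) (2*n+1≡1+double n) ⟩
    ℤ→ℚ (+ moment (double r) (suc (double n))) * h       ≡⟨ cong (λ z → ℤ→ℚ z * h) (moment-Q̄ r n) ⟩
    ℤ→ℚ (t ℤ.* q) * h                                    ≡⟨ cong (_* h) (ℤ→ℚ-* t q) ⟩
    ℤ→ℚ t * ℤ→ℚ q * h
      ≡⟨ solve 3 (λ t q h → t :* q :* h := t :* h :* q) refl (ℤ→ℚ t) (ℤ→ℚ q) h ⟩
    ℤ→ℚ t * h * ℤ→ℚ q                                    ≡⟨ cong (λ u → u * h * ℤ→ℚ q) (ℤ→ℚ-2^ (suc (double n))) ⟩
    ℕ→ℚ 2 ^ℚ suc (double n) * h * ℤ→ℚ q                  ≡⟨ cong (λ e → ℕ→ℚ 2 ^ℚ e * h * ℤ→ℚ q) (2*n+1≡1+double n) ⟨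
    ℕ→ℚ 2 ^ℚ (2 ℕ.* n ℕ.+ 1) * h * ℤ→ℚ q                 ∎
    where
    open ≡-Reasoning
    h = ½ ^ℚ (2 ℕ.* r)
    t = (+ 2) ℤ.^ suc (double n)
    q = ⟦ Q̄ᵥ r ⟧ (+ n)

open import Defs
open import Data.Nat as ℕ using (ℕ; suc; NonZero)
open import Data.Nat.Combinatorics using (_C_)
open import Data.Integer as ℤ using (ℤ; +_)
open import Data.Rational as ℚ using (ℚ; ½)
open import Data.Product using (Σ; _×_; _,_)
open import Relation.Binary.PropositionalEquality using (_≡_)
open import Data.Vec using (toList)

open Polynomials
  using (Pᵥ; P̄ᵥ; Qᵥ; Q̄ᵥ; Pᵥ-hasDegree; P̄ᵥ-hasDegree; Qᵥ-hasDegree; Q̄ᵥ-hasDegree; P-rec; P̄-rec; Q-rec; Q̄-rec; ⟦constant⟧)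
open RationalMoments using (U-P; U-P̄; U-Q; U-Q̄)

theorem2 : Σ (ℕ → Poly) λ P → Σ (ℕ → Poly) λ P̄ → Σ (ℕ → Poly) λ Q → Σ (ℕ → Poly) λ Q̄ →
    ((r : ℕ) → HasDegree (P r) r × HasDegree (P̄ r) r × HasDegree (Q r) r × HasDegree (Q̄ r) r)
    × ((r n : ℕ) → .{{_ : NonZero n}} →
        (U (2 ℕ.* r ℕ.+ 1) (2 ℕ.* n)
          ≡ ℕ→ℚ n ℚ.* ℤ→ℚ (eval (P r) (+ n)) ℚ.* ℕ→ℚ ((2 ℕ.* n) C n))
        × (U (2 ℕ.* r ℕ.+ 1) (2 ℕ.* n ℕ.∸ 1)
          ≡ (½ ^ℚ (2 ℕ.* r ℕ.+ 1)) ℚ.* ℕ→ℚ n ℚ.* ℤ→ℚ (eval (P̄ r) (+ n)) ℚ.* ℕ→ℚ ((2 ℕ.* n) C n))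
        × (U (2 ℕ.* r) (2 ℕ.* n)
          ≡ (ℕ→ℚ 2 ^ℚ (2 ℕ.* n)) ℚ.* (½ ^ℚ r) ℚ.* ℤ→ℚ (eval (Q r) (+ n)))
        × (U (2 ℕ.* r) (2 ℕ.* n ℕ.+ 1)
          ≡ (ℕ→ℚ 2 ^ℚ (2 ℕ.* n ℕ.+ 1)) ℚ.* (½ ^ℚ (2 ℕ.* r)) ℚ.* ℤ→ℚ (eval (Q̄ r) (+ n))))
    × ((r : ℕ) → (n : ℤ) →
        (eval (P (suc r)) n
          ≡ n ℤ.* n ℤ.* eval (P r) n ℤ.- n ℤ.* (n ℤ.- + 1) ℤ.* eval (P r) (n ℤ.- + 1))
        × (eval (P̄ (suc r)) n
          ≡ (+ 2 ℤ.* n ℤ.- + 1) ℤ.* (+ 2 ℤ.* n ℤ.- + 1) ℤ.* eval (P̄ r) n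
            ℤ.- + 4 ℤ.* ((n ℤ.- + 1) ℤ.* (n ℤ.- + 1)) ℤ.* eval (P̄ r) (n ℤ.- + 1))
        × (eval (Q (suc r)) n
          ≡ + 2 ℤ.* (n ℤ.* n) ℤ.* eval (Q r) n ℤ.- n ℤ.* (+ 2 ℤ.* n ℤ.- + 1) ℤ.* eval (Q r) (n ℤ.- + 1))
        × (eval (Q̄ (suc r)) n
          ≡ (+ 2 ℤ.* n ℤ.+ + 1) ℤ.* (+ 2 ℤ.* n ℤ.+ + 1) ℤ.* eval (Q̄ r) n
            ℤ.- + 2 ℤ.* n ℤ.* (+ 2 ℤ.* n ℤ.+ + 1) ℤ.* eval (Q̄ r) (n ℤ.- + 1)))
    × ((n : ℤ) → (eval (P 0) n ≡ + 1) × (eval (P̄ 0) n ≡ + 1) × (eval (Q 0) n ≡ + 1) × (eval (Q̄ 0) n ≡ + 1))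
theorem2 = (λ r → toList (Pᵥ r)) , (λ r → toList (P̄ᵥ r)) , (λ r → toList (Qᵥ r)) , (λ r → toList (Q̄ᵥ r))
  , (λ r → Pᵥ-hasDegree r , P̄ᵥ-hasDegree r , Qᵥ-hasDegree r , Q̄ᵥ-hasDegree r)
  , (λ r n → U-P r n , U-P̄ r n , U-Q r n , U-Q̄ r n)
  , (λ r x → P-rec r x , P̄-rec r x , Q-rec r x , Q̄-rec r x)
  , (λ x → ⟦constant⟧ (+ 1) x , ⟦constant⟧ (+ 1) x , ⟦constant⟧ (+ 1) x , ⟦constant⟧ (+ 1) x)
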